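{- Let $k\ge1$, $c\in\{0,\dots,k\}$, let $\lambda$ be a partition contained in $R=(c^{k+1-c})$, and let $\mathfrak X$ be a set of cells of $\lambda$ satisfying (C2): whenever $(i_a,j_a),(i_b,j_b)\in\mathfrak X$ with $i_a>i_b$ and $j_a<j_b$, the cell $(i_a,j_b)$ is not in $\lambda$. Then $\ell(w_{\lambda\setminus\mathfrak X})=\ell(w_\lambda)-|\mathfrak X|$; that is, the reading word of $\lambda\setminus\mathfrak X$ is a reduced word in $W$.
   Context: Affine symmetric group $W$: bijections $w:\mathbb Z\to\mathbb Z$ with $w(m+k+1)=w(m)+k+1$ and $\sum_{m=1}^{k+1}w(m)=\sum_{m=1}^{k+1}m$, with Coxeter generators $s_0,\dots,s_k$ ($s_r$ exchanges $r+t(k+1)$ and $r+1+t(k+1)$ for all $t$) and Coxeter length $\ell$; $s_a:=s_{a\bmod(k+1)}$. Diagrams: cell $(p,q)$ in row $p$ (from top), column $q$ (from left), residue $(q-p)\bmod(k+1)$. For a set $\mathcal D$ of cells, the reading word is $s_{r_1}\cdots s_{r_m}$ where $r_1,\dots,r_m$ are the residues read starting in the bottom row, each row right to left, rows bottom to top, and $w_{\mathcal D}$ is the corresponding element of $W$; $w_\lambda$ is this for the diagram of $\lambda$, and $\lambda\setminus\mathfrak X$ removes the cells of $\mathfrak X$. -}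

module Defs where

open import Data.Nat as ℕ using (ℕ; zero; suc; _≤_; _<_; _≡ᵇ_; _≤ᵇ_; _∸_)
open import Data.Nat.DivMod using (_%_)
open import Data.Integer as ℤ using (ℤ; +_; _%ℕ_)
open import Data.Bool using (Bool; true; false; if_then_else_; _∧_; not)
open import Data.List using (List; []; _∷_; _++_; length)
open import Data.Bool.ListAction using (any)
open import Data.List.Relation.Unary.All using (All)
open import Data.List.Relation.Unary.Unique.Propositional using (Unique)
open import Data.List.Relation.Unary.Linked using (Linked)
open import Data.List.Membership.Propositional using (_∈_)
open import Data.Product using (Σ; _×_; _,_)
open import Relation.Binary.PropositionalEquality using (_≡_)
open import Relation.Nullary using (¬_)

-- Affine symmetric group of rank k (period n = k+1), acting on ℤ.
-- A word is a list of letters a : ℕ, letter a standing for s_{a mod (k+1)}.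

Word : Set
Word = List ℕ

-- generator s_r : exchanges r + t(k+1) and r+1 + t(k+1) for all t
gen : (k : ℕ) → ℕ → ℤ → ℤ
gen k a x =
  let r = a % suc k
      m = x %ℕ suc k
  in if m ≡ᵇ r then x ℤ.+ ℤ.1ℤ
     else if m ≡ᵇ (suc r % suc k) then x ℤ.- ℤ.1ℤ
     else x

act : (k : ℕ) → Word → ℤ → ℤ
act k [] x = x
act k (a ∷ u) x = gen k a (act k u x)

_≈[_]_ : Word → ℕ → Word → Set
u ≈[ k ] v = ∀ x → act k u x ≡ act k v x

IsLength : (k : ℕ) → Word → ℕ → Set
IsLength k u n =
  (Σ Word λ v → (length v ≡ n) × (v ≈[ k ] u)) ×
  (∀ v → v ≈[ k ] u → n ≤ length v)

Reduced : (k : ℕ) → Word → Set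
Reduced k u = ∀ v → v ≈[ k ] u → length u ≤ length v

-- Partitions and diagrams.  Cells (p , q): row p, column q, 1-indexed.

Cell : Set
Cell = ℕ × ℕ

IsPartition : List ℕ → Set
IsPartition lam = Linked (λ a b → b ≤ a) lam × All (λ a → 1 ≤ a) lam

rowLen : List ℕ → ℕ → ℕ
rowLen []        _             = 0
rowLen (x ∷ _)   (suc zero)    = x
rowLen (_ ∷ xs)  (suc (suc p)) = rowLen xs (suc p)
rowLen (_ ∷ _)   zero          = 0

InRect : List ℕ → (c rows : ℕ) → Set
InRect lam c rows = (length lam ≤ rows) × All (λ a → a ≤ c) lam

InDiagram : List ℕ → Cell → Set
InDiagram lam (p , q) = (1 ≤ q) × (q ≤ rowLen lam p)

inDiagramᵇ : List ℕ → ℕ → ℕ → Bool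
inDiagramᵇ lam p q = (1 ≤ᵇ q) ∧ (q ≤ᵇ rowLen lam p)

memberᵇ : List Cell → ℕ → ℕ → Bool
memberᵇ X p q = any (λ { (i , j) → (i ≡ᵇ p) ∧ (j ≡ᵇ q) }) X

residue : (k : ℕ) → ℕ → ℕ → ℕ
residue k p q = (+ q ℤ.- + p) %ℕ suc k

-- reading word of a set D of cells contained in rows 1..nr, columns 1..nc:
-- rows bottom to top, each row right to left
readRow : (k : ℕ) → (ℕ → ℕ → Bool) → ℕ → ℕ → Word
readRow k D p zero = []
readRow k D p (suc q) =
  (if D p (suc q) then residue k p (suc q) ∷ [] else []) ++ readRow k D p q

readRows : (k : ℕ) → (ℕ → ℕ → Bool) → (nr nc : ℕ) → Word
readRows k D zero nc = []
readRows k D (suc p) nc = readRow k D (suc p) nc ++ readRows k D p nc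

readingWordMinus : (k : ℕ) → List ℕ → List Cell → (nr nc : ℕ) → Word
readingWordMinus k lam X nr nc =
  readRows k (λ p q → inDiagramᵇ lam p q ∧ not (memberᵇ X p q)) nr nc

C2 : List ℕ → List Cell → Set
C2 lam X = ∀ ia ja ib jb → (ia , ja) ∈ X → (ib , jb) ∈ X →
  ib < ia → ja < jb → ¬ InDiagram lam (ia , jb)

-- The length of any word is at least the number of inversions, inside a
-- window of N = k + 1 consecutive integers (one per residue class), of the
-- affine permutation it represents: a generator changes that number by at
-- most one.  Conversely, read the (k + 1 − c) × c rectangle as a pipe dream
-- whose crossings are the cells of λ ∖ 𝔛 and whose elbows are the other cells;
-- applying the letters of the reading word from right to left processes the
-- cells row by row from the top, left to right.  Each crossing adds exactly
-- one window inversion, because the two pipes meeting there have not crossed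
-- before: otherwise the elbows that brought them together again would be
-- cells of 𝔛 weakly north-west of a cell of λ, and the cell at their corner
-- would violate (C2).

module Submission where

open import Defs
open import Data.Nat using (ℕ; zero; suc; _≤_; _<_; _≟_; _+_; _*_; _∸_; z≤n; s≤s; z<s; _≡ᵇ_; _≤ᵇ_)
open import Data.Nat.Properties
open import Data.Nat.DivMod using (_%_; m<n⇒m%n≡m; n%n≡0; m%n<n)
open import Data.Integer as ℤ using (ℤ; +_; -[1+_]; _%ℕ_)
import Data.Integer.Properties as ℤP
open import Data.Integer.DivMod using (a≡a%ℕn+[a/ℕn]*n; n%ℕd<d)
open import Data.Integer.Tactic.RingSolver using (solve-∀)
open import Data.Bool using (Bool; true; false; T; if_then_else_; _∧_; _∨_; not)
open import Data.Bool.Properties using (∧-zeroʳ; ∧-conicalˡ; ∧-conicalʳ)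
open import Data.List using (List; []; _∷_; _++_; length; filter; applyUpTo; cartesianProduct)
open import Data.List.Properties using (filter-none; filter-some; filter-≐; ++-assoc; length-++)
open import Data.List.Membership.Propositional using (_∈_)
open import Data.List.Membership.Propositional.Properties using (∈-applyUpTo⁺; ∈-applyUpTo⁻; ∈-cartesianProduct⁺; ∈-cartesianProduct⁻)
open import Data.List.Relation.Unary.Unique.Propositional.Properties using (applyUpTo⁺₁; cartesianProduct⁺)
open import Data.List.Relation.Unary.Any using (Any; here; there)
import Data.List.Relation.Unary.Any as Any
open import Data.List.Relation.Unary.AllPairs using (_∷_)
import Data.List.Relation.Unary.All as All
open import Data.List.Relation.Unary.All using (All; []; _∷_)
open import Data.List.Relation.Unary.Linked using (Linked; _∷_)
import Data.List.Relation.Unary.Linked as Linked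
open import Data.List.Relation.Unary.Unique.Propositional using (Unique)
open import Data.Product using (Σ; _×_; _,_; proj₁; proj₂; map₁)
open import Data.Sum using (_⊎_; inj₁; inj₂)
open import Data.Empty using (⊥; ⊥-elim)
open import Relation.Nullary using (¬_; yes; no; _×-dec_)
open import Relation.Unary using (Pred; Decidable; _∩_; ∁; _≐_)
open import Relation.Unary.Properties using (_∩?_; ∁?)
open import Level using (0ℓ)
open import Relation.Binary.PropositionalEquality
open import Relation.Binary.Definitions using (tri<; tri≈; tri>)
open import Function using (_∘_)
open import Algebra.Properties.CommutativeSemigroup +-commutativeSemigroup using (interchange)

≡ᵇ-true⇒≡ : ∀ {m n} → (m ≡ᵇ n) ≡ true → m ≡ n
≡ᵇ-true⇒≡ {m} {n} e = ≡ᵇ⇒≡ m n (subst T (sym e) _)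

≡ᵇ-false⇒≢ : ∀ {m n} → (m ≡ᵇ n) ≡ false → m ≢ n
≡ᵇ-false⇒≢ {m} {n} e m≡n = subst T e (≡⇒≡ᵇ m n m≡n)

≤⇒≡+ : ∀ {x y} → x ℤ.≤ y → Σ ℕ λ d → y ≡ x ℤ.+ + d
≤⇒≡+ {x} {y} x≤y = ℤ.∣ y ℤ.- x ∣ , trans (split x y) (cong (ℤ._+_ x) (sym (ℤP.0≤i⇒+∣i∣≡i (ℤP.i≤j⇒0≤j-i x≤y))))
  where split : ∀ x y → y ≡ x ℤ.+ (y ℤ.- x)
        split = solve-∀

private
  -x+[x+a]≡a : ∀ x a → ℤ.- x ℤ.+ (x ℤ.+ a) ≡ a
  -x+[x+a]≡a = solve-∀

+-cancelˡ-<ℤ : ∀ x {a b} → x ℤ.+ a ℤ.< x ℤ.+ b → a ℤ.< b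
+-cancelˡ-<ℤ x {a} {b} h = subst₂ ℤ._<_ (-x+[x+a]≡a x a) (-x+[x+a]≡a x b) (ℤP.+-monoʳ-< (ℤ.- x) h)

+-cancelˡ-≡ℤ : ∀ x {a b} → x ℤ.+ a ≡ x ℤ.+ b → a ≡ b
+-cancelˡ-≡ℤ x {a} {b} h = trans (sym (-x+[x+a]≡a x a)) (trans (cong (ℤ._+_ (ℤ.- x)) h) (-x+[x+a]≡a x b))

+-cancelˡ-≤ℤ : ∀ x {a b} → x ℤ.+ a ℤ.≤ x ℤ.+ b → a ℤ.≤ b
+-cancelˡ-≤ℤ x {a} {b} h = subst₂ ℤ._≤_ (-x+[x+a]≡a x a) (-x+[x+a]≡a x b) (ℤP.+-monoʳ-≤ (ℤ.- x) h)

module Residues (k : ℕ) where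

  N : ℕ
  N = suc k

  private
    pos-split : ∀ m r n → + m ≡ + r ℤ.+ + n → m ≡ r + n
    pos-split m r n e = ℤP.+-injective (trans e (sym (ℤP.pos-+ r n)))

    N≤r+[1+j]N : ∀ r j → N ≤ r + suc j * N
    N≤r+[1+j]N r j = ≤-trans (m≤m+n N (j * N)) (m≤n+m (suc j * N) r)

  %ℕ-unique : ∀ m r (t : ℤ) → m < N → r < N → + m ≡ + r ℤ.+ t ℤ.* + N → m ≡ r
  %ℕ-unique m r (+ zero) _ _ e = ℤP.+-injective (trans e (ℤP.+-identityʳ (+ r)))
  %ℕ-unique m r (+ suc j) m<N _ e =
    ⊥-elim (<-irrefl refl (<-≤-trans m<N (≤-trans (N≤r+[1+j]N r j) (≤-reflexive (sym m≡)))))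
    where
      m≡ : m ≡ r + suc j * N
      m≡ = pos-split m r (suc j * N) (trans e (cong (ℤ._+_ (+ r)) (sym (ℤP.pos-* (suc j) N))))
  %ℕ-unique m r -[1+ j ] _ r<N e =
    ⊥-elim (<-irrefl refl (<-≤-trans r<N (≤-trans (N≤r+[1+j]N m j) (≤-reflexive (sym r≡)))))
    where
      isolate : ∀ m r t n → m ≡ r ℤ.+ (ℤ.- t) ℤ.* n → r ≡ m ℤ.+ t ℤ.* n
      isolate m r t n e = trans (expand r t n) (cong (λ z → z ℤ.+ t ℤ.* n) (sym e))
        where expand : ∀ r t n → r ≡ (r ℤ.+ (ℤ.- t) ℤ.* n) ℤ.+ t ℤ.* n
              expand = solve-∀
      r≡ : r ≡ m + suc j * N
      r≡ = pos-split r m (suc j * N)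
             (trans (isolate (+ m) (+ r) (+ suc j) (+ N) e) (cong (ℤ._+_ (+ m)) (sym (ℤP.pos-* (suc j) N))))

  %N<N : ∀ x → x %ℕ N < N
  %N<N x = n%ℕd<d x N

  decompose : ∀ x → x ≡ + (x %ℕ N) ℤ.+ (x ℤ./ℕ N) ℤ.* + N
  decompose x = a≡a%ℕn+[a/ℕn]*n x N

  %ℕ-from-decomposition : ∀ x m (t : ℤ) → m < N → x ≡ + m ℤ.+ t ℤ.* + N → x %ℕ N ≡ m
  %ℕ-from-decomposition x m t m<N e =
    %ℕ-unique (x %ℕ N) m (t ℤ.- x ℤ./ℕ N) (%N<N x) m<N (regroup (+ (x %ℕ N)) (+ m) (x ℤ./ℕ N) t (+ N) eq)
    where
      eq : + (x %ℕ N) ℤ.+ (x ℤ./ℕ N) ℤ.* + N ≡ + m ℤ.+ t ℤ.* + N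
      eq = trans (sym (decompose x)) e
      regroup : ∀ r m q t n → r ℤ.+ q ℤ.* n ≡ m ℤ.+ t ℤ.* n → r ≡ m ℤ.+ (t ℤ.- q) ℤ.* n
      regroup r m q t n e = trans (expand r q n) (trans (cong (λ z → z ℤ.+ (ℤ.- q) ℤ.* n) e) (collect m t q n))
        where
          expand : ∀ r q n → r ≡ (r ℤ.+ q ℤ.* n) ℤ.+ (ℤ.- q) ℤ.* n
          expand = solve-∀
          collect : ∀ m t q n → (m ℤ.+ t ℤ.* n) ℤ.+ (ℤ.- q) ℤ.* n ≡ m ℤ.+ (t ℤ.- q) ℤ.* n
          collect = solve-∀

  private
    suc-%-cases : ∀ a → a < N → (suc a < N × suc a % N ≡ suc a) ⊎ (suc a ≡ N × suc a % N ≡ 0)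
    suc-%-cases a a<N with m≤n⇒m<n∨m≡n a<N
    ... | inj₁ lt = inj₁ (lt , m<n⇒m%n≡m lt)
    ... | inj₂ eq = inj₂ (eq , trans (cong (_% N) eq) (n%n≡0 N))

  suc-%-injective : ∀ a b → a < N → b < N → suc a % N ≡ suc b % N → a ≡ b
  suc-%-injective a b a<N b<N e with suc-%-cases a a<N | suc-%-cases b b<N
  ... | inj₁ (_ , ea) | inj₁ (_ , eb) = suc-injective (trans (sym ea) (trans e eb))
  ... | inj₁ (_ , ea) | inj₂ (_ , eb) with () ← trans (sym ea) (trans e eb)
  ... | inj₂ (_ , ea) | inj₁ (_ , eb) with () ← trans (sym eb) (trans (sym e) ea)
  ... | inj₂ (ea , _) | inj₂ (eb , _) = suc-injective (trans ea (sym eb))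

  suc-%-≢ : 1 ≤ k → ∀ r → r < N → suc r % N ≢ r
  suc-%-≢ 1≤k r r<N e with suc-%-cases r r<N
  ... | inj₁ (_ , e') = 1+n≢n (trans (sym e') e)
  ... | inj₂ (1+r≡N , e') with () ← subst (1 ≤_) (suc-injective (trans (sym 1+r≡N) (cong suc (trans (sym e) e')))) 1≤k

  [x+1]%N≡[1+x%N]%N : ∀ x → (x ℤ.+ ℤ.1ℤ) %ℕ N ≡ suc (x %ℕ N) % N
  [x+1]%N≡[1+x%N]%N x with suc-%-cases (x %ℕ N) (%N<N x)
  ... | inj₁ (lt , e) = trans (%ℕ-from-decomposition _ _ (x ℤ./ℕ N) lt eq) (sym e)
    where
      shift : ∀ r q n → (r ℤ.+ q ℤ.* n) ℤ.+ ℤ.1ℤ ≡ (ℤ.1ℤ ℤ.+ r) ℤ.+ q ℤ.* n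
      shift = solve-∀
      eq : x ℤ.+ ℤ.1ℤ ≡ + suc (x %ℕ N) ℤ.+ (x ℤ./ℕ N) ℤ.* + N
      eq = trans (cong (ℤ._+ ℤ.1ℤ) (decompose x)) (shift (+ (x %ℕ N)) (x ℤ./ℕ N) (+ N))
  ... | inj₂ (1+r≡N , e) = trans (%ℕ-from-decomposition _ 0 (x ℤ./ℕ N ℤ.+ ℤ.1ℤ) z<s eq) (sym e)
    where
      wrap : ∀ r q n → (r ℤ.+ q ℤ.* n) ℤ.+ ℤ.1ℤ ≡ (ℤ.1ℤ ℤ.+ r ℤ.- n) ℤ.+ (q ℤ.+ ℤ.1ℤ) ℤ.* n
      wrap = solve-∀
      vanish : ℤ.1ℤ ℤ.+ + (x %ℕ N) ℤ.- + N ≡ + 0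
      vanish = trans (cong (λ n → + n ℤ.- + N) 1+r≡N) (ℤP.+-inverseʳ (+ N))
      eq : x ℤ.+ ℤ.1ℤ ≡ + 0 ℤ.+ (x ℤ./ℕ N ℤ.+ ℤ.1ℤ) ℤ.* + N
      eq = trans (cong (ℤ._+ ℤ.1ℤ) (decompose x))
             (trans (wrap (+ (x %ℕ N)) (x ℤ./ℕ N) (+ N)) (cong (ℤ._+ (x ℤ./ℕ N ℤ.+ ℤ.1ℤ) ℤ.* + N) vanish))

  [1+[x-1]%N]%N≡x%N : ∀ x → suc ((x ℤ.- ℤ.1ℤ) %ℕ N) % N ≡ x %ℕ N
  [1+[x-1]%N]%N≡x%N x = trans (sym ([x+1]%N≡[1+x%N]%N (x ℤ.- ℤ.1ℤ))) (cong (_%ℕ N) (cancel x))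
    where cancel : ∀ x → (x ℤ.- ℤ.1ℤ) ℤ.+ ℤ.1ℤ ≡ x
          cancel = solve-∀

  [x+d]%N≡x%N⇒d≡0 : ∀ x d → d < N → (x ℤ.+ + d) %ℕ N ≡ x %ℕ N → d ≡ 0
  [x+d]%N≡x%N⇒d≡0 x d d<N e = cases (<-≤-connex (r + d) N)
    where
      r : ℕ
      r = x %ℕ N
      q : ℤ
      q = x ℤ./ℕ N
      x+d≡ : x ℤ.+ + d ≡ + (r + d) ℤ.+ q ℤ.* + N
      x+d≡ = trans (cong (ℤ._+ + d) (decompose x)) (trans (regroup (+ r) q (+ d) (+ N)) (cong (ℤ._+ q ℤ.* + N) (sym (ℤP.pos-+ r d))))
        where regroup : ∀ r q d n → (r ℤ.+ q ℤ.* n) ℤ.+ d ≡ (r ℤ.+ d) ℤ.+ q ℤ.* n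
              regroup = solve-∀
      cases : r + d < N ⊎ N ≤ r + d → d ≡ 0
      cases (inj₁ r+d<N) = +-cancelˡ-≡ r d 0 (trans (sym (%ℕ-from-decomposition _ _ q r+d<N x+d≡)) (trans e (sym (+-identityʳ r))))
      cases (inj₂ N≤r+d) = ⊥-elim (<-irrefl d≡N d<N)
        where
          t : ℕ
          t = r + d ∸ N
          t+N≡r+d : t + N ≡ r + d
          t+N≡r+d = m∸n+n≡m N≤r+d
          t<N : t < N
          t<N = +-cancelʳ-< N t N (subst (_< N + N) (sym t+N≡r+d) (+-mono-< (%N<N x) d<N))
          collect : ∀ t n q → (t ℤ.+ n) ℤ.+ q ℤ.* n ≡ t ℤ.+ (q ℤ.+ ℤ.1ℤ) ℤ.* n
          collect = solve-∀
          x+d≡' : x ℤ.+ + d ≡ + t ℤ.+ (q ℤ.+ ℤ.1ℤ) ℤ.* + N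
          x+d≡' = trans x+d≡ (trans (cong (λ n → + n ℤ.+ q ℤ.* + N) (sym t+N≡r+d))
                                    (trans (cong (ℤ._+ q ℤ.* + N) (ℤP.pos-+ t N)) (collect (+ t) (+ N) q)))
          d≡N : d ≡ N
          d≡N = +-cancelˡ-≡ r d N (trans (sym t+N≡r+d) (cong (_+ N) (trans (sym (%ℕ-from-decomposition _ t (q ℤ.+ ℤ.1ℤ) t<N x+d≡')) e)))

module Counting {A : Set} where

  count : {P : Pred A 0ℓ} → Decidable P → List A → ℕ
  count P? xs = length (filter P? xs)

  module _ {P Q : Pred A 0ℓ} (P? : Decidable P) (Q? : Decidable Q) where

    count-≤-+-new : ∀ xs → count Q? xs ≤ count P? xs + count (Q? ∩? ∁? P?) xs
    count-≤-+-new [] = z≤n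
    count-≤-+-new (x ∷ xs) with P? x | Q? x
    ... | yes _ | yes _ = s≤s (count-≤-+-new xs)
    ... | yes _ | no _ = m≤n⇒m≤1+n (count-≤-+-new xs)
    ... | no _ | yes _ = subst (suc (count Q? xs) ≤_) (sym (+-suc _ _)) (s≤s (count-≤-+-new xs))
    ... | no _ | no _ = count-≤-+-new xs

    count-+-new-≤ : ∀ xs → (∀ {x} → x ∈ xs → P x → Q x) → count P? xs + count (Q? ∩? ∁? P?) xs ≤ count Q? xs
    count-+-new-≤ [] _ = z≤n
    count-+-new-≤ (x ∷ xs) P⊆Q with P? x | Q? x
    ... | yes _ | yes _ = s≤s (count-+-new-≤ xs (P⊆Q ∘ there))
    ... | yes p | no ¬q = ⊥-elim (¬q (P⊆Q (here refl) p))
    ... | no _ | yes _ = subst (_≤ suc (count Q? xs)) (sym (+-suc _ _)) (s≤s (count-+-new-≤ xs (P⊆Q ∘ there)))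
    ... | no _ | no _ = count-+-new-≤ xs (P⊆Q ∘ there)

  count-≤1 : ∀ {P : Pred A 0ℓ} (P? : Decidable P) {xs} → Unique xs →
             (∀ {x y} → x ∈ xs → y ∈ xs → P x → P y → x ≡ y) → count P? xs ≤ 1
  count-≤1 P? {[]} _ _ = z≤n
  count-≤1 P? {x ∷ xs} (x∉xs ∷ uniq) atMostOne with P? x
  ... | yes px = ≤-reflexive (cong suc (cong length (filter-none P? (All.tabulate λ y∈xs py →
                   All.lookup x∉xs y∈xs (atMostOne (here refl) (there y∈xs) px py)))))
  ... | no _ = count-≤1 P? uniq (λ x∈ y∈ → atMostOne (there x∈) (there y∈))

module Generators (k : ℕ) where

  open Residues k

  data GenCase (a : ℕ) (x : ℤ) : Set where
    raises : x %ℕ N ≡ a % N → gen k a x ≡ x ℤ.+ ℤ.1ℤ → GenCase a x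
    lowers : x %ℕ N ≢ a % N → x %ℕ N ≡ suc (a % N) % N → gen k a x ≡ x ℤ.- ℤ.1ℤ → GenCase a x
    fixes  : x %ℕ N ≢ a % N → x %ℕ N ≢ suc (a % N) % N → gen k a x ≡ x → GenCase a x

  private
    genUnlessRaised : ℕ → ℤ → ℤ
    genUnlessRaised a x = if x %ℕ N ≡ᵇ suc (a % N) % N then x ℤ.- ℤ.1ℤ else x

  genCase : ∀ a x → GenCase a x
  genCase a x with x %ℕ N ≡ᵇ a % N in e₁
  ... | true = raises (≡ᵇ-true⇒≡ e₁) (cong (if_then x ℤ.+ ℤ.1ℤ else genUnlessRaised a x) e₁)
  ... | false with x %ℕ N ≡ᵇ suc (a % N) % N in e₂
  ...   | true = lowers (≡ᵇ-false⇒≢ e₁) (≡ᵇ-true⇒≡ e₂)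
                   (trans (cong (if_then x ℤ.+ ℤ.1ℤ else genUnlessRaised a x) e₁) (cong (if_then x ℤ.- ℤ.1ℤ else x) e₂))
  ...   | false = fixes (≡ᵇ-false⇒≢ e₁) (≡ᵇ-false⇒≢ e₂)
                   (trans (cong (if_then x ℤ.+ ℤ.1ℤ else genUnlessRaised a x) e₁) (cong (if_then x ℤ.- ℤ.1ℤ else x) e₂))

  gen-resp-% : ∀ a x y → x %ℕ N ≡ y %ℕ N → gen k a x %ℕ N ≡ gen k a y %ℕ N
  gen-resp-% a x y e with genCase a x | genCase a y
  ... | raises _ gx | raises _ gy rewrite gx | gy =
    trans ([x+1]%N≡[1+x%N]%N x) (trans (cong (λ z → suc z % N) e) (sym ([x+1]%N≡[1+x%N]%N y)))
  ... | raises px _ | lowers py _ _ = ⊥-elim (py (trans (sym e) px))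
  ... | raises px _ | fixes py _ _ = ⊥-elim (py (trans (sym e) px))
  ... | lowers px _ _ | raises py _ = ⊥-elim (px (trans e py))
  ... | lowers _ _ gx | lowers _ _ gy rewrite gx | gy =
    suc-%-injective _ _ (%N<N (x ℤ.- ℤ.1ℤ)) (%N<N (y ℤ.- ℤ.1ℤ))
      (trans ([1+[x-1]%N]%N≡x%N x) (trans e (sym ([1+[x-1]%N]%N≡x%N y))))
  ... | lowers _ px _ | fixes _ py _ = ⊥-elim (py (trans (sym e) px))
  ... | fixes px _ _ | raises py _ = ⊥-elim (px (trans e py))
  ... | fixes _ px _ | lowers _ py _ = ⊥-elim (px (trans e py))
  ... | fixes _ _ gx | fixes _ _ gy rewrite gx | gy = e

  gen-involutive : 1 ≤ k → ∀ a x → gen k a (gen k a x) ≡ x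
  gen-involutive 1≤k a x with genCase a x
  ... | raises raised gx rewrite gx with genCase a (x ℤ.+ ℤ.1ℤ)
  ...   | raises raised' _ =
    ⊥-elim (suc-%-≢ 1≤k (a % N) (m%n<n a N) (trans (cong (λ z → suc z % N) (sym raised)) (trans (sym ([x+1]%N≡[1+x%N]%N x)) raised')))
  ...   | lowers _ _ g₂ rewrite g₂ = cancel x
    where cancel : ∀ x → x ℤ.+ ℤ.1ℤ ℤ.- ℤ.1ℤ ≡ x
          cancel = solve-∀
  ...   | fixes _ ¬lowered _ = ⊥-elim (¬lowered (trans ([x+1]%N≡[1+x%N]%N x) (cong (λ z → suc z % N) raised)))
  gen-involutive 1≤k a x | lowers _ lowered gx rewrite gx with genCase a (x ℤ.- ℤ.1ℤ)
  ...   | raises _ g₂ rewrite g₂ = cancel x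
    where cancel : ∀ x → x ℤ.- ℤ.1ℤ ℤ.+ ℤ.1ℤ ≡ x
          cancel = solve-∀
  ...   | lowers ¬raised _ _ = ⊥-elim (¬raised (suc-%-injective _ _ (%N<N (x ℤ.- ℤ.1ℤ)) (m%n<n a N) (trans ([1+[x-1]%N]%N≡x%N x) lowered)))
  ...   | fixes ¬raised _ _ = ⊥-elim (¬raised (suc-%-injective _ _ (%N<N (x ℤ.- ℤ.1ℤ)) (m%n<n a N) (trans ([1+[x-1]%N]%N≡x%N x) lowered)))
  gen-involutive 1≤k a x | fixes _ _ gx rewrite gx = gx

  gen≤x+1 : ∀ a x → gen k a x ℤ.≤ x ℤ.+ ℤ.1ℤ
  gen≤x+1 a x with genCase a x
  ... | raises _ g rewrite g = ℤP.≤-refl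
  ... | lowers _ _ g rewrite g = ℤP.+-monoʳ-≤ x (ℤ.-≤+ {0} {1})
  ... | fixes _ _ g rewrite g = ℤP.i≤i+j x ℤ.1ℤ

  gen≤x : ∀ a x → x %ℕ N ≢ a % N → gen k a x ℤ.≤ x
  gen≤x a x ¬raised with genCase a x
  ... | raises p _ = ⊥-elim (¬raised p)
  ... | lowers _ _ g rewrite g = ℤP.i-j≤i x ℤ.1ℤ
  ... | fixes _ _ g rewrite g = ℤP.≤-refl

  x-1≤gen : ∀ a x → x ℤ.- ℤ.1ℤ ℤ.≤ gen k a x
  x-1≤gen a x with genCase a x
  ... | raises _ g rewrite g = ℤP.+-monoʳ-≤ x (ℤ.-≤+ {0} {1})
  ... | lowers _ _ g rewrite g = ℤP.≤-refl
  ... | fixes _ _ g rewrite g = ℤP.i-j≤i x ℤ.1ℤ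

  gen-inversion : ∀ a x y → x ℤ.≤ y → gen k a y ℤ.< gen k a x → (y ≡ x ℤ.+ ℤ.1ℤ) × (x %ℕ N ≡ a % N)
  gen-inversion a x y x≤y gy<gx with ≤⇒≡+ x≤y
  ... | d , refl = close d gy<gx d<2
    where
      d<2 : d < 2
      d<2 = ℤP.drop‿+<+ (+-cancelˡ-<ℤ (x ℤ.- ℤ.1ℤ) (subst₂ ℤ._<_ (shift x (+ d)) (two x)
              (ℤP.≤-<-trans (x-1≤gen a (x ℤ.+ + d)) (ℤP.<-≤-trans gy<gx (gen≤x+1 a x)))))
        where
          shift : ∀ x d → (x ℤ.+ d) ℤ.- ℤ.1ℤ ≡ (x ℤ.- ℤ.1ℤ) ℤ.+ d
          shift = solve-∀
          two : ∀ x → x ℤ.+ ℤ.1ℤ ≡ (x ℤ.- ℤ.1ℤ) ℤ.+ + 2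
          two = solve-∀
      close : ∀ d → gen k a (x ℤ.+ + d) ℤ.< gen k a x → d < 2 → (x ℤ.+ + d ≡ x ℤ.+ ℤ.1ℤ) × (x %ℕ N ≡ a % N)
      close zero lt _ = ⊥-elim (ℤP.<-irrefl (cong (gen k a) (ℤP.+-identityʳ x)) lt)
      close (suc zero) lt _ with x %ℕ N ≟ a % N
      ... | yes raised = refl , raised
      ... | no ¬raised = ⊥-elim (ℤP.<-irrefl refl (ℤP.<-≤-trans lt (ℤP.≤-trans (gen≤x a x ¬raised) x≤gen[x+1])))
        where
          x≤gen[x+1] : x ℤ.≤ gen k a (x ℤ.+ + 1)
          x≤gen[x+1] = subst (ℤ._≤ gen k a (x ℤ.+ + 1)) (cancel x) (x-1≤gen a (x ℤ.+ + 1))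
            where cancel : ∀ x → x ℤ.+ + 1 ℤ.- ℤ.1ℤ ≡ x
                  cancel = solve-∀
      close (suc (suc d)) _ (s≤s (s≤s ()))

module Window (k : ℕ) (1≤k : 1 ≤ k) (lo : ℤ) where

  open Residues k
  open Generators k
  open Counting

  InWindow : ℤ → Set
  InWindow y = lo ℤ.≤ y × y ℤ.< lo ℤ.+ + N

  window : List ℤ
  window = applyUpTo (λ d → lo ℤ.+ + d) N

  ∈-window⁻ : ∀ {y} → y ∈ window → InWindow y
  ∈-window⁻ y∈ with ∈-applyUpTo⁻ (λ d → lo ℤ.+ + d) y∈
  ... | d , d<N , refl = ℤP.i≤i+j lo (+ d) , ℤP.+-monoʳ-< lo (ℤ.+<+ d<N)

  ∈-window⁺ : ∀ {y} → InWindow y → y ∈ window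
  ∈-window⁺ (lo≤y , y<hi) with ≤⇒≡+ lo≤y
  ... | d , refl = ∈-applyUpTo⁺ (λ d → lo ℤ.+ + d) (ℤP.drop‿+<+ (+-cancelˡ-<ℤ lo y<hi))

  window-unique : Unique window
  window-unique = applyUpTo⁺₁ (λ d → lo ℤ.+ + d) N (λ d<d' _ e → <⇒≢ d<d' (ℤP.+-injective (+-cancelˡ-≡ℤ lo e)))

  private
    %ℕ-injective-upward : ∀ {i j} → i ℤ.≤ j → lo ℤ.≤ i → j ℤ.< lo ℤ.+ + N → i %ℕ N ≡ j %ℕ N → i ≡ j
    %ℕ-injective-upward {i} i≤j lo≤i j<hi e with ≤⇒≡+ i≤j
    ... | d , refl = sym (trans (cong (λ d → i ℤ.+ + d) d≡0) (ℤP.+-identityʳ i))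
      where
        d<N : d < N
        d<N = ℤP.drop‿+<+ (+-cancelˡ-<ℤ i (ℤP.<-≤-trans j<hi (ℤP.+-monoˡ-≤ (+ N) lo≤i)))
        d≡0 : d ≡ 0
        d≡0 = [x+d]%N≡x%N⇒d≡0 i d d<N (sym e)

  %ℕ-injective-on-window : ∀ {i j} → InWindow i → InWindow j → i %ℕ N ≡ j %ℕ N → i ≡ j
  %ℕ-injective-on-window {i} {j} (lo≤i , i<hi) (lo≤j , j<hi) e with ℤP.≤-total i j
  ... | inj₁ i≤j = %ℕ-injective-upward i≤j lo≤i j<hi e
  ... | inj₂ j≤i = sym (%ℕ-injective-upward j≤i lo≤j i<hi (sym e))

  pairs : List (ℤ × ℤ)
  pairs = cartesianProduct window window

  Inverted : (ℤ → ℤ) → Pred (ℤ × ℤ) 0ℓ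
  Inverted f (i , j) = i ℤ.< j × f j ℤ.< f i

  inverted? : ∀ f → Decidable (Inverted f)
  inverted? f (i , j) = (i ℤ.<? j) ×-dec (f j ℤ.<? f i)

  inversions : (ℤ → ℤ) → ℕ
  inversions f = count (inverted? f) pairs

  ∈-pairs⁻ : ∀ {i j} → (i , j) ∈ pairs → InWindow i × InWindow j
  ∈-pairs⁻ p with ∈-cartesianProduct⁻ window window p
  ... | i∈ , j∈ = ∈-window⁻ i∈ , ∈-window⁻ j∈

  ∈-pairs⁺ : ∀ {i j} → InWindow i → InWindow j → (i , j) ∈ pairs
  ∈-pairs⁺ wi wj = ∈-cartesianProduct⁺ (∈-window⁺ wi) (∈-window⁺ wj)

  ResidueInjective : (ℤ → ℤ) → Set
  ResidueInjective f = ∀ {i j} → InWindow i → InWindow j → f i %ℕ N ≡ f j %ℕ N → i ≡ j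

  act-residueInjective : ∀ v → ResidueInjective (act k v)
  act-residueInjective [] = %ℕ-injective-on-window
  act-residueInjective (a ∷ v) {i} {j} wi wj e = act-residueInjective v wi wj
    (trans (cong (_%ℕ N) (sym (gen-involutive 1≤k a (act k v i))))
      (trans (gen-resp-% a (gen k a (act k v i)) (gen k a (act k v j)) e) (cong (_%ℕ N) (gen-involutive 1≤k a (act k v j)))))

  -- A new inversion of s_a ∘ f is a pair with values x + 1 and x, x ≡ a
  -- (mod N); residue-injectivity of f leaves at most one such pair.
  inversions-gen-≤ : ∀ f a → ResidueInjective f → inversions (gen k a ∘ f) ≤ inversions f + 1
  inversions-gen-≤ f a inj =
    ≤-trans (count-≤-+-new (inverted? f) (inverted? (gen k a ∘ f)) pairs)
            (+-monoʳ-≤ (inversions f) (count-≤1 (inverted? (gen k a ∘ f) ∩? ∁? (inverted? f))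
              (cartesianProduct⁺ window-unique window-unique) atMostOne))
    where
      adjacent : ∀ {i j} → (Inverted (gen k a ∘ f) ∩ ∁ (Inverted f)) (i , j) → (f j ≡ f i ℤ.+ ℤ.1ℤ) × (f i %ℕ N ≡ a % N)
      adjacent ((i<j , new) , ¬old) = gen-inversion a _ _ (ℤP.≮⇒≥ (λ fj<fi → ¬old (i<j , fj<fi))) new
      atMostOne : ∀ {e e'} → e ∈ pairs → e' ∈ pairs →
                  (Inverted (gen k a ∘ f) ∩ ∁ (Inverted f)) e → (Inverted (gen k a ∘ f) ∩ ∁ (Inverted f)) e' → e ≡ e'
      atMostOne {i , j} {i' , j'} m m' h h' with ∈-pairs⁻ m | ∈-pairs⁻ m' | adjacent h | adjacent h'
      ... | wi , wj | wi' , wj' | fj≡ , fi% | fj'≡ , fi'% with inj wi wi' (trans fi% (sym fi'%))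
      ... | refl = cong (i ,_) (inj wj wj' (cong (_%ℕ N) (trans fj≡ (sym fj'≡))))

  inversions≤length : ∀ v → inversions (act k v) ≤ length v
  inversions≤length [] = ≤-reflexive (cong length (filter-none (inverted? (act k [])) (All.tabulate not-inverted)))
    where not-inverted : ∀ {e} → e ∈ pairs → ¬ Inverted (act k []) e
          not-inverted {i , j} _ (i<j , j<i) = ℤP.<-asym i<j j<i
  inversions≤length (a ∷ v) =
    ≤-trans (inversions-gen-≤ (act k v) a (act-residueInjective v))
            (subst (_≤ suc (length v)) (+-comm 1 _) (s≤s (inversions≤length v)))

module Diagrams where

  private
    Weakly≥ : List ℕ → Set
    Weakly≥ = Linked (λ a b → b ≤ a)

    rowLen-tail≤head : ∀ x xs → Weakly≥ (x ∷ xs) → ∀ p → rowLen xs p ≤ x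
    rowLen-tail≤head x [] _ p = z≤n
    rowLen-tail≤head x (y ∷ ys) _ zero = z≤n
    rowLen-tail≤head x (y ∷ ys) (y≤x ∷ _) (suc zero) = y≤x
    rowLen-tail≤head x (y ∷ ys) (y≤x ∷ l) (suc (suc p)) = ≤-trans (rowLen-tail≤head y ys l (suc p)) y≤x

    rowLen-antitone : ∀ lam → Weakly≥ lam → ∀ {p' p} → 1 ≤ p' → p' ≤ p → rowLen lam p ≤ rowLen lam p'
    rowLen-antitone [] _ _ _ = z≤n
    rowLen-antitone (x ∷ xs) _ {suc zero} {suc zero} _ _ = ≤-refl
    rowLen-antitone (x ∷ xs) l {suc zero} {suc (suc p)} _ _ = rowLen-tail≤head x xs l (suc p)
    rowLen-antitone (x ∷ xs) l {suc (suc p')} {suc (suc p)} _ (s≤s p'≤p) =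
      rowLen-antitone xs (Linked.tail l) {suc p'} {suc p} (s≤s z≤n) p'≤p

  InDiagram-downClosed : ∀ {lam} → IsPartition lam → ∀ {p q p' q'} → InDiagram lam (p , q) →
                         1 ≤ p' → p' ≤ p → 1 ≤ q' → q' ≤ q → InDiagram lam (p' , q')
  InDiagram-downClosed {lam} (weakly≥ , _) (_ , q≤row) 1≤p' p'≤p 1≤q' q'≤q =
    1≤q' , ≤-trans q'≤q (≤-trans q≤row (rowLen-antitone lam weakly≥ 1≤p' p'≤p))

  rowLen≤ : ∀ {lam c} → All (_≤ c) lam → ∀ p → rowLen lam p ≤ c
  rowLen≤ [] p = z≤n
  rowLen≤ (x≤c ∷ _) zero = z≤n
  rowLen≤ (x≤c ∷ _) (suc zero) = x≤c
  rowLen≤ (_ ∷ all≤c) (suc (suc p)) = rowLen≤ all≤c (suc p)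

  nonempty-row≤length : ∀ lam p → 1 ≤ rowLen lam p → 1 ≤ p × p ≤ length lam
  nonempty-row≤length [] p ()
  nonempty-row≤length (x ∷ lam) zero ()
  nonempty-row≤length (x ∷ lam) (suc zero) _ = s≤s z≤n , s≤s z≤n
  nonempty-row≤length (x ∷ lam) (suc (suc p)) h = s≤s z≤n , s≤s (proj₂ (nonempty-row≤length lam (suc p) h))

private
  +-shift : ∀ y a a' b → y ℤ.+ + a ≡ + b → + (a + a') ℤ.+ y ≡ + (b + a')
  +-shift y a a' b e = begin
    + (a + a') ℤ.+ y        ≡⟨ cong (ℤ._+ y) (ℤP.pos-+ a a') ⟩
    (+ a ℤ.+ + a') ℤ.+ y    ≡⟨ regroup (+ a) (+ a') y ⟩
    (y ℤ.+ + a) ℤ.+ + a'    ≡⟨ cong (ℤ._+ + a') e ⟩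
    + b ℤ.+ + a'            ≡⟨ ℤP.pos-+ b a' ⟨
    + (b + a')              ∎
    where
      open ≡-Reasoning
      regroup : ∀ a a' y → (a ℤ.+ a') ℤ.+ y ≡ (y ℤ.+ a) ℤ.+ a'
      regroup = solve-∀

  +-shift' : ∀ z a a' b' → z ℤ.+ + a' ≡ + b' → + (a + a') ℤ.+ z ≡ + (b' + a)
  +-shift' z a a' b' e = subst (λ n → + n ℤ.+ z ≡ + (b' + a)) (+-comm a' a) (+-shift z a' a b' e)

diagonal-≤ : ∀ y z {a b a' b'} → y ℤ.+ + a ≡ + b → z ℤ.+ + a' ≡ + b' → b + a' ≤ b' + a → y ℤ.≤ z
diagonal-≤ y z {a} {b} {a'} {b'} ey ez h =
  +-cancelˡ-≤ℤ (+ (a + a')) (subst₂ ℤ._≤_ (sym (+-shift y a a' b ey)) (sym (+-shift' z a a' b' ez)) (ℤ.+≤+ h))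

diagonal-< : ∀ y z {a b a' b'} → y ℤ.+ + a ≡ + b → z ℤ.+ + a' ≡ + b' → b + a' < b' + a → y ℤ.< z
diagonal-< y z {a} {b} {a'} {b'} ey ez h =
  +-cancelˡ-<ℤ (+ (a + a')) (subst₂ ℤ._<_ (sym (+-shift y a a' b ey)) (sym (+-shift' z a a' b' ez)) (ℤ.+<+ h))

diagonal-≡ : ∀ y {a b a' b'} → y ℤ.+ + a ≡ + b → y ℤ.+ + a' ≡ + b' → b + a' ≡ b' + a
diagonal-≡ y {a} {b} {a'} {b'} ey ey' = ℤP.+-injective (trans (sym (+-shift y a a' b ey)) (+-shift' y a a' b' ey'))

≡-diagonal : ∀ y z {a b a' b'} → y ℤ.+ + a ≡ + b → z ℤ.+ + a' ≡ + b' → b + a' ≡ b' + a → y ≡ z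
≡-diagonal y z ey ez h = ℤP.≤-antisym (diagonal-≤ y z ey ez (≤-reflexive h)) (diagonal-≤ z y ez ey (≤-reflexive (sym h)))

memberᵇ⇒∈ : ∀ Y {p q} → memberᵇ Y p q ≡ true → (p , q) ∈ Y
memberᵇ⇒∈ ((i , j) ∷ Y) {p} {q} e with i ≡ᵇ p in e₁ | j ≡ᵇ q in e₂
... | true | true = here (sym (cong₂ _,_ (≡ᵇ-true⇒≡ e₁) (≡ᵇ-true⇒≡ e₂)))
... | true | false = there (memberᵇ⇒∈ Y e)
... | false | _ = there (memberᵇ⇒∈ Y e)

inDiagramᵇ⇒InDiagram : ∀ lam {p q} → inDiagramᵇ lam p q ≡ true → InDiagram lam (p , q)
inDiagramᵇ⇒InDiagram lam {p} {q} e with 1 ≤ᵇ q in e₁ | q ≤ᵇ rowLen lam p in e₂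
... | true | true = ≤ᵇ⇒≤ 1 q (subst T (sym e₁) _) , ≤ᵇ⇒≤ q (rowLen lam p) (subst T (sym e₂) _)

InDiagram⇒inDiagramᵇ : ∀ lam {p q} → InDiagram lam (p , q) → inDiagramᵇ lam p q ≡ true
InDiagram⇒inDiagramᵇ lam (1≤q , q≤row) = cong₂ _∧_ (T⇒≡true (≤⇒≤ᵇ 1≤q)) (T⇒≡true (≤⇒≤ᵇ q≤row))
  where T⇒≡true : ∀ {b} → T b → b ≡ true
        T⇒≡true {true} _ = refl

module Pipes (k : ℕ) (1≤k : 1 ≤ k) (c : ℕ) (c≤k : c ≤ k) (lam : List ℕ) (X : List Cell)
             (partition : IsPartition lam) (c2 : C2 lam X) where

  open Residues k
  open Generators k
  open Counting
  open Diagrams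

  R : ℕ
  R = suc k ∸ c

  R+c≡N : R + c ≡ N
  R+c≡N = m∸n+n≡m (m≤n⇒m≤1+n c≤k)

  open Window k 1≤k (ℤ.1ℤ ℤ.- + R) public

  Elbow : ℕ → ℕ → Set
  Elbow r s = ¬ InDiagram lam (r , s) ⊎ (r , s) ∈ X

  -- The cells of the R × c rectangle are processed row by row, left to right.
  -- After all rows < P and the first q cells of row P, the boundary between
  -- processed and unprocessed cells is a lattice path of N edges: the edge
  -- below cell (r , s) carries the label s − r, the edge to the right of cell
  -- (r , s) (s = 0: the left border) the label s + 1 − r, and these labels
  -- form the window.  The letter of cell (P , 1 + q) acts on the window as
  -- the transposition of the labels of its left and top edges.

  data HEdge (P q : ℕ) (y : ℤ) : ℕ → ℕ → Set where
    current  : ∀ {s} → 1 ≤ s → s ≤ q → y ℤ.+ + P ≡ + s → HEdge P q y P s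
    previous : ∀ {r s} → suc r ≡ P → q < s → s ≤ c → y ℤ.+ + r ≡ + s → HEdge P q y r s

  data VEdge (P q : ℕ) (y : ℤ) : ℕ → ℕ → Set where
    leftBorder  : ∀ {r} → P < r → y ℤ.+ + r ≡ + 1 → VEdge P q y r 0
    corner      : y ℤ.+ + P ≡ + suc q → VEdge P q y P q
    rightBorder : ∀ {r} → r < P → y ℤ.+ + r ≡ + suc c → VEdge P q y r c

  Edge : (P q : ℕ) → ℤ → ℕ → ℕ → Set
  Edge P q y r s = HEdge P q y r s ⊎ VEdge P q y r s

  -- Crossed P q u v: the pipes now ending at the edges labelled u and v
  -- crossed at a processed cell (p' , q'), u leaving it downwards and v to
  -- the right.  Of their further course only the first elbow in that column
  -- resp. row is recorded, or else the boundary edge reached directly.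

  ExitsDown : (P q p' q' : ℕ) → ℤ → Set
  ExitsDown P q p' q' y =
      (Σ ℕ λ r → Σ ℕ λ s → HEdge P q y r s × s ≡ q' × p' ≤ r)
    ⊎ (Σ ℕ λ r₀ → p' < r₀ × Elbow r₀ q' × Σ ℕ λ r → Σ ℕ λ s → Edge P q y r s × r₀ ≤ r)

  ExitsRight : (P q p' q' : ℕ) → ℤ → Set
  ExitsRight P q p' q' y =
      (Σ ℕ λ r → Σ ℕ λ s → VEdge P q y r s × r ≡ p' × q' ≤ s)
    ⊎ (Σ ℕ λ s₀ → q' < s₀ × Elbow p' s₀ × Σ ℕ λ r → Σ ℕ λ s → Edge P q y r s × s₀ ≤ s)

  Crossed : (P q : ℕ) → ℤ → ℤ → Set
  Crossed P q u v = Σ ℕ λ p' → Σ ℕ λ q' → 1 ≤ p' × 1 ≤ q' × ExitsDown P q p' q' u × ExitsRight P q p' q' v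

  record PipeInvariant (P q : ℕ) (f : ℤ → ℤ) : Set where
    field
      maps-window : ∀ {i} → InWindow i → InWindow (f i)
      onto-window : ∀ {y} → InWindow y → Σ ℤ λ i → InWindow i × f i ≡ y
      inversion-crossed : ∀ {i j} → InWindow i → InWindow j → i ℤ.< j → f j ℤ.< f i → Crossed P q (f j) (f i)

  module _ {P q P' q' : ℕ} {y y' : ℤ}
           (hedge : ∀ {r s} → HEdge P q y r s → HEdge P' q' y' r s)
           (vedge : ∀ {r s} → VEdge P q y r s → VEdge P' q' y' r s) where

    Edge-map : ∀ {r s} → Edge P q y r s → Edge P' q' y' r s
    Edge-map (inj₁ h) = inj₁ (hedge h)
    Edge-map (inj₂ v) = inj₂ (vedge v)

    ExitsDown-map : ∀ {p₀ q₀} → ExitsDown P q p₀ q₀ y → ExitsDown P' q' p₀ q₀ y'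
    ExitsDown-map (inj₁ (r , s , h , s≡ , ≤r)) = inj₁ (r , s , hedge h , s≡ , ≤r)
    ExitsDown-map (inj₂ (r₀ , p₀<r₀ , elbow , r , s , e , ≤r)) = inj₂ (r₀ , p₀<r₀ , elbow , r , s , Edge-map e , ≤r)

    ExitsRight-map : ∀ {p₀ q₀} → ExitsRight P q p₀ q₀ y → ExitsRight P' q' p₀ q₀ y'
    ExitsRight-map (inj₁ (r , s , v , r≡ , ≤s)) = inj₁ (r , s , vedge v , r≡ , ≤s)
    ExitsRight-map (inj₂ (s₀ , q₀<s₀ , elbow , r , s , e , ≤s)) = inj₂ (s₀ , q₀<s₀ , elbow , r , s , Edge-map e , ≤s)

  Crossed-map : ∀ {P q P' q'} →
                (∀ {y r s} → HEdge P q y r s → HEdge P' q' y r s) →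
                (∀ {y r s} → VEdge P q y r s → VEdge P' q' y r s) →
                ∀ {u v} → Crossed P q u v → Crossed P' q' u v
  Crossed-map hedge vedge {u} {v} (p' , q' , 1≤p' , 1≤q' , down , right) =
    p' , q' , 1≤p' , 1≤q' , ExitsDown-map {y = u} {y' = u} hedge vedge down , ExitsRight-map {y = v} {y' = v} hedge vedge right

  HEdge-nextRow : ∀ {P y r s} → HEdge P c y r s → HEdge (suc P) 0 y r s
  HEdge-nextRow (current 1≤s s≤c e) = previous refl 1≤s s≤c e
  HEdge-nextRow (previous _ c<s s≤c _) = ⊥-elim (<-irrefl refl (<-≤-trans c<s s≤c))

  VEdge-nextRow : ∀ {P y r s} → VEdge P c y r s → VEdge (suc P) 0 y r s
  VEdge-nextRow (leftBorder P<r e) with m≤n⇒m<n∨m≡n P<r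
  ... | inj₁ 1+P<r = leftBorder 1+P<r e
  ... | inj₂ refl = corner e
  VEdge-nextRow {P} (corner e) = rightBorder (n<1+n P) e
  VEdge-nextRow (rightBorder r<P e) = rightBorder (m<n⇒m<1+n r<P) e

  PipeInvariant-nextRow : ∀ {P f} → PipeInvariant P c f → PipeInvariant (suc P) 0 f
  PipeInvariant-nextRow inv = record
    { maps-window = maps-window
    ; onto-window = onto-window
    ; inversion-crossed = λ wi wj i<j fj<fi → Crossed-map HEdge-nextRow VEdge-nextRow (inversion-crossed wi wj i<j fj<fi)
    }
    where open PipeInvariant inv

  module AtCell (P q : ℕ) (1+q≤c : suc q ≤ c) (1≤P : 1 ≤ P) (P≤R : P ≤ R) where

    private
      subtract-add : ∀ a b → (a ℤ.- b) ℤ.+ b ≡ a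
      subtract-add = solve-∀

    yLeft : ℤ
    yLeft = + suc q ℤ.- + P

    yTop : ℤ
    yTop = yLeft ℤ.+ ℤ.1ℤ

    yLeft+P : yLeft ℤ.+ + P ≡ + suc q
    yLeft+P = subtract-add (+ suc q) (+ P)

    yTop+P : yTop ℤ.+ + P ≡ + suc (suc q)
    yTop+P = trans (regroup (+ suc q) (+ P)) (sym (ℤP.pos-+ 1 (suc q)))
      where regroup : ∀ a b → ((a ℤ.- b) ℤ.+ ℤ.1ℤ) ℤ.+ b ≡ ℤ.1ℤ ℤ.+ a
            regroup = solve-∀

    yLeft<yTop : yLeft ℤ.< yTop
    yLeft<yTop = diagonal-< yLeft yTop yLeft+P yTop+P (n<1+n (suc q + P))

    private
      lo+R : (ℤ.1ℤ ℤ.- + R) ℤ.+ + R ≡ + 1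
      lo+R = subtract-add ℤ.1ℤ (+ R)

      hi+R : ((ℤ.1ℤ ℤ.- + R) ℤ.+ + N) ℤ.+ + R ≡ + suc N
      hi+R = trans (regroup ℤ.1ℤ (+ R) (+ N)) (sym (ℤP.pos-+ 1 N))
        where regroup : ∀ a b n → ((a ℤ.- b) ℤ.+ n) ℤ.+ b ≡ a ℤ.+ n
              regroup = solve-∀

      lo≤yLeft : ℤ.1ℤ ℤ.- + R ℤ.≤ yLeft
      lo≤yLeft = diagonal-≤ (ℤ.1ℤ ℤ.- + R) yLeft lo+R yLeft+P (s≤s (≤-trans P≤R (m≤n+m R q)))

      yTop<hi : yTop ℤ.< (ℤ.1ℤ ℤ.- + R) ℤ.+ + N
      yTop<hi = diagonal-< yTop ((ℤ.1ℤ ℤ.- + R) ℤ.+ + N) yTop+P hi+R (begin-strict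
        suc (suc q) + R  ≤⟨ +-monoˡ-≤ R (s≤s 1+q≤c) ⟩
        suc c + R        ≡⟨ cong suc (trans (+-comm c R) R+c≡N) ⟩
        suc N            <⟨ m<m+n (suc N) 1≤P ⟩
        suc N + P        ∎)
        where open ≤-Reasoning

    inWindow-yLeft : InWindow yLeft
    inWindow-yLeft = lo≤yLeft , ℤP.<-trans yLeft<yTop yTop<hi

    inWindow-yTop : InWindow yTop
    inWindow-yTop = ℤP.≤-trans lo≤yLeft (ℤP.<⇒≤ yLeft<yTop) , yTop<hi

    ¬HEdge-yLeft : ∀ {r s} → ¬ HEdge P q yLeft r s
    ¬HEdge-yLeft (current _ s≤q e) = <-irrefl (sym (+-cancelʳ-≡ P (suc q) _ (diagonal-≡ yLeft yLeft+P e))) (s≤s s≤q)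
    ¬HEdge-yLeft {r} {s} (previous refl q<s _ e) =
      <-irrefl (+-cancelʳ-≡ r q s (suc-injective (trans (diagonal-≡ yLeft yLeft+P e) (+-suc s r)))) q<s

    VEdge-yLeft : ∀ {r s} → VEdge P q yLeft r s → r ≡ P × s ≡ q
    VEdge-yLeft {r} (leftBorder P<r e) =
      ⊥-elim (<-irrefl refl (<-≤-trans P<r (≤-trans (m≤n+m r q) (≤-reflexive (suc-injective (diagonal-≡ yLeft yLeft+P e))))))
    VEdge-yLeft (corner _) = refl , refl
    VEdge-yLeft (rightBorder r<P e) = ⊥-elim (<-irrefl (diagonal-≡ yLeft yLeft+P e) (<-≤-trans (+-mono-≤-< 1+q≤c r<P) (n≤1+n _)))

    ¬VEdge-yTop : ∀ {r s} → ¬ VEdge P q yTop r s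
    ¬VEdge-yTop {r} (leftBorder P<r e) =
      <-irrefl refl (<-≤-trans P<r (≤-trans (m≤n+m r (suc q)) (≤-reflexive (suc-injective (diagonal-≡ yTop yTop+P e)))))
    ¬VEdge-yTop (corner e) = 1+n≢n (+-cancelʳ-≡ P _ _ (diagonal-≡ yTop yTop+P e))
    ¬VEdge-yTop (rightBorder r<P e) = <-irrefl (suc-injective (diagonal-≡ yTop yTop+P e)) (+-mono-≤-< 1+q≤c r<P)

    HEdge-yTop : ∀ {r s} → HEdge P q yTop r s → suc r ≡ P × s ≡ suc q
    HEdge-yTop {s = s} (current _ s≤q e) = ⊥-elim (<-irrefl (sym (+-cancelʳ-≡ P _ s (diagonal-≡ yTop yTop+P e))) (s≤s (m≤n⇒m≤1+n s≤q)))
    HEdge-yTop {r} {s} (previous refl _ _ e) =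
      refl , sym (+-cancelʳ-≡ r (suc q) s (suc-injective (trans (diagonal-≡ yTop yTop+P e) (+-suc s r))))

    HEdge-yLeft-new : HEdge P (suc q) yLeft P (suc q)
    HEdge-yLeft-new = current (s≤s z≤n) ≤-refl yLeft+P

    VEdge-yTop-new : VEdge P (suc q) yTop P (suc q)
    VEdge-yTop-new = corner yTop+P

    HEdge-other : ∀ {z r s} → z ≢ yTop → HEdge P q z r s → HEdge P (suc q) z r s
    HEdge-other _ (current 1≤s s≤q e) = current 1≤s (m≤n⇒m≤1+n s≤q) e
    HEdge-other {z} {r} {s} z≢yTop (previous refl q<s s≤c e) with s ≟ suc q
    ... | yes refl = ⊥-elim (z≢yTop (≡-diagonal z yTop e yTop+P (+-suc (suc q) r)))
    ... | no s≢1+q = previous refl (≤∧≢⇒< q<s (s≢1+q ∘ sym)) s≤c e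

    VEdge-other : ∀ {z r s} → z ≢ yLeft → VEdge P q z r s → VEdge P (suc q) z r s
    VEdge-other _ (leftBorder P<r e) = leftBorder P<r e
    VEdge-other {z} z≢yLeft (corner e) = ⊥-elim (z≢yLeft (≡-diagonal z yLeft e yLeft+P refl))
    VEdge-other _ (rightBorder r<P e) = rightBorder r<P e

    private
      1+r≡P⇒r≤P : ∀ {r} → suc r ≡ P → r ≤ P
      1+r≡P⇒r≤P refl = n≤1+n _

      s≡q⇒s≤1+q : ∀ {s} → s ≡ q → s ≤ suc q
      s≡q⇒s≤1+q refl = n≤1+n _

    module _ {p' q' : ℕ} where

      ExitsDown-cross-yLeft : ExitsDown P q p' q' yLeft → ExitsDown P (suc q) p' q' yTop
      ExitsDown-cross-yLeft (inj₁ (_ , _ , h , _)) = ⊥-elim (¬HEdge-yLeft h)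
      ExitsDown-cross-yLeft (inj₂ (_ , _ , _ , _ , _ , inj₁ h , _)) = ⊥-elim (¬HEdge-yLeft h)
      ExitsDown-cross-yLeft (inj₂ (r₀ , p'<r₀ , elbow , _ , _ , inj₂ v , r₀≤r)) =
        inj₂ (r₀ , p'<r₀ , elbow , P , suc q , inj₂ VEdge-yTop-new , subst (r₀ ≤_) (proj₁ (VEdge-yLeft v)) r₀≤r)

      ExitsDown-cross-yTop : ExitsDown P q p' q' yTop → ExitsDown P (suc q) p' q' yLeft
      ExitsDown-cross-yTop (inj₁ (_ , _ , h , s≡q' , p'≤r)) with HEdge-yTop h
      ... | 1+r≡P , refl = inj₁ (P , suc q , HEdge-yLeft-new , s≡q' , ≤-trans p'≤r (1+r≡P⇒r≤P 1+r≡P))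
      ExitsDown-cross-yTop (inj₂ (r₀ , p'<r₀ , elbow , _ , _ , inj₁ h , r₀≤r)) =
        inj₂ (r₀ , p'<r₀ , elbow , P , suc q , inj₁ HEdge-yLeft-new , ≤-trans r₀≤r (1+r≡P⇒r≤P (proj₁ (HEdge-yTop h))))
      ExitsDown-cross-yTop (inj₂ (_ , _ , _ , _ , _ , inj₂ v , _)) = ⊥-elim (¬VEdge-yTop v)

      ExitsRight-cross-yLeft : ExitsRight P q p' q' yLeft → ExitsRight P (suc q) p' q' yTop
      ExitsRight-cross-yLeft (inj₁ (_ , _ , v , r≡p' , q'≤s)) with VEdge-yLeft v
      ... | refl , s≡q = inj₁ (P , suc q , VEdge-yTop-new , r≡p' , ≤-trans q'≤s (s≡q⇒s≤1+q s≡q))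
      ExitsRight-cross-yLeft (inj₂ (_ , _ , _ , _ , _ , inj₁ h , _)) = ⊥-elim (¬HEdge-yLeft h)
      ExitsRight-cross-yLeft (inj₂ (s₀ , q'<s₀ , elbow , _ , _ , inj₂ v , s₀≤s)) =
        inj₂ (s₀ , q'<s₀ , elbow , P , suc q , inj₂ VEdge-yTop-new , ≤-trans s₀≤s (s≡q⇒s≤1+q (proj₂ (VEdge-yLeft v))))

      ExitsRight-cross-yTop : ExitsRight P q p' q' yTop → ExitsRight P (suc q) p' q' yLeft
      ExitsRight-cross-yTop (inj₁ (_ , _ , v , _)) = ⊥-elim (¬VEdge-yTop v)
      ExitsRight-cross-yTop (inj₂ (s₀ , q'<s₀ , elbow , _ , _ , inj₁ h , s₀≤s)) =
        inj₂ (s₀ , q'<s₀ , elbow , P , suc q , inj₁ HEdge-yLeft-new , subst (s₀ ≤_) (proj₂ (HEdge-yTop h)) s₀≤s)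
      ExitsRight-cross-yTop (inj₂ (_ , _ , _ , _ , _ , inj₂ v , _)) = ⊥-elim (¬VEdge-yTop v)

      module _ (elbow : Elbow P (suc q)) where

        ExitsDown-elbow-yLeft : ExitsDown P q p' q' yLeft → ExitsDown P (suc q) p' q' yLeft
        ExitsDown-elbow-yLeft (inj₁ (_ , _ , h , _)) = ⊥-elim (¬HEdge-yLeft h)
        ExitsDown-elbow-yLeft (inj₂ (_ , _ , _ , _ , _ , inj₁ h , _)) = ⊥-elim (¬HEdge-yLeft h)
        ExitsDown-elbow-yLeft (inj₂ (r₀ , p'<r₀ , elbow₀ , _ , _ , inj₂ v , r₀≤r)) =
          inj₂ (r₀ , p'<r₀ , elbow₀ , P , suc q , inj₁ HEdge-yLeft-new , subst (r₀ ≤_) (proj₁ (VEdge-yLeft v)) r₀≤r)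

        ExitsDown-elbow-yTop : ExitsDown P q p' q' yTop → ExitsDown P (suc q) p' q' yTop
        ExitsDown-elbow-yTop (inj₁ (_ , _ , h , refl , p'≤r)) with HEdge-yTop h
        ... | refl , refl = inj₂ (P , s≤s p'≤r , elbow , P , suc q , inj₂ VEdge-yTop-new , ≤-refl)
        ExitsDown-elbow-yTop (inj₂ (r₀ , p'<r₀ , elbow₀ , _ , _ , inj₁ h , r₀≤r)) =
          inj₂ (r₀ , p'<r₀ , elbow₀ , P , suc q , inj₂ VEdge-yTop-new , ≤-trans r₀≤r (1+r≡P⇒r≤P (proj₁ (HEdge-yTop h))))
        ExitsDown-elbow-yTop (inj₂ (_ , _ , _ , _ , _ , inj₂ v , _)) = ⊥-elim (¬VEdge-yTop v)

        ExitsRight-elbow-yLeft : ExitsRight P q p' q' yLeft → ExitsRight P (suc q) p' q' yLeft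
        ExitsRight-elbow-yLeft (inj₁ (_ , _ , v , refl , q'≤s)) with VEdge-yLeft v
        ... | refl , refl = inj₂ (suc q , s≤s q'≤s , elbow , P , suc q , inj₁ HEdge-yLeft-new , ≤-refl)
        ExitsRight-elbow-yLeft (inj₂ (_ , _ , _ , _ , _ , inj₁ h , _)) = ⊥-elim (¬HEdge-yLeft h)
        ExitsRight-elbow-yLeft (inj₂ (s₀ , q'<s₀ , elbow₀ , _ , _ , inj₂ v , s₀≤s)) =
          inj₂ (s₀ , q'<s₀ , elbow₀ , P , suc q , inj₁ HEdge-yLeft-new , ≤-trans s₀≤s (s≡q⇒s≤1+q (proj₂ (VEdge-yLeft v))))

        ExitsRight-elbow-yTop : ExitsRight P q p' q' yTop → ExitsRight P (suc q) p' q' yTop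
        ExitsRight-elbow-yTop (inj₁ (_ , _ , v , _)) = ⊥-elim (¬VEdge-yTop v)
        ExitsRight-elbow-yTop (inj₂ (s₀ , q'<s₀ , elbow₀ , _ , _ , inj₁ h , s₀≤s)) =
          inj₂ (s₀ , q'<s₀ , elbow₀ , P , suc q , inj₂ VEdge-yTop-new , subst (s₀ ≤_) (proj₂ (HEdge-yTop h)) s₀≤s)
        ExitsRight-elbow-yTop (inj₂ (_ , _ , _ , _ , _ , inj₂ v , _)) = ⊥-elim (¬VEdge-yTop v)

      ExitsDown-other : ∀ {z} → z ≢ yLeft → z ≢ yTop → ExitsDown P q p' q' z → ExitsDown P (suc q) p' q' z
      ExitsDown-other z≢yLeft z≢yTop = ExitsDown-map (HEdge-other z≢yTop) (VEdge-other z≢yLeft)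

      ExitsRight-other : ∀ {z} → z ≢ yLeft → z ≢ yTop → ExitsRight P q p' q' z → ExitsRight P (suc q) p' q' z
      ExitsRight-other z≢yLeft z≢yTop = ExitsRight-map (HEdge-other z≢yTop) (VEdge-other z≢yLeft)

    private
      elbow-below-yLeft : ∀ {p' q'} → ExitsDown P q p' q' yLeft → Σ ℕ λ r₀ → p' < r₀ × Elbow r₀ q' × r₀ ≤ P
      elbow-below-yLeft (inj₁ (_ , _ , h , _)) = ⊥-elim (¬HEdge-yLeft h)
      elbow-below-yLeft (inj₂ (_ , _ , _ , _ , _ , inj₁ h , _)) = ⊥-elim (¬HEdge-yLeft h)
      elbow-below-yLeft (inj₂ (r₀ , p'<r₀ , elbow , _ , _ , inj₂ v , r₀≤r)) =
        r₀ , p'<r₀ , elbow , subst (r₀ ≤_) (proj₁ (VEdge-yLeft v)) r₀≤r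

      elbow-rightOf-yTop : ∀ {p' q'} → ExitsRight P q p' q' yTop → Σ ℕ λ s₀ → q' < s₀ × Elbow p' s₀ × s₀ ≤ suc q
      elbow-rightOf-yTop (inj₁ (_ , _ , v , _)) = ⊥-elim (¬VEdge-yTop v)
      elbow-rightOf-yTop (inj₂ (s₀ , q'<s₀ , elbow , _ , _ , inj₁ h , s₀≤s)) =
        s₀ , q'<s₀ , elbow , subst (s₀ ≤_) (proj₂ (HEdge-yTop h)) s₀≤s
      elbow-rightOf-yTop (inj₂ (_ , _ , _ , _ , _ , inj₂ v , _)) = ⊥-elim (¬VEdge-yTop v)

    -- The elbows below and to the right of an earlier crossing of the two
    -- pipes lie weakly north-west of (P , 1 + q), so they are cells of λ in 𝔛,
    -- and then (C2) excludes the cell at their corner, which is also in λ.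
    ¬Crossed-yLeft-yTop : InDiagram lam (P , suc q) → ¬ Crossed P q yLeft yTop
    ¬Crossed-yLeft-yTop cell (p' , q' , 1≤p' , 1≤q' , down , right) with elbow-below-yLeft down | elbow-rightOf-yTop right
    ... | r₀ , p'<r₀ , inj₁ outside , r₀≤P | s₀ , q'<s₀ , _ , s₀≤1+q =
      outside (InDiagram-downClosed partition cell (≤-trans (s≤s z≤n) p'<r₀) r₀≤P 1≤q' (≤-trans (<⇒≤ q'<s₀) s₀≤1+q))
    ... | r₀ , p'<r₀ , inj₂ _ , r₀≤P | s₀ , q'<s₀ , inj₁ outside , s₀≤1+q =
      outside (InDiagram-downClosed partition cell 1≤p' (≤-trans (<⇒≤ p'<r₀) r₀≤P) (≤-trans (s≤s z≤n) q'<s₀) s₀≤1+q)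
    ... | r₀ , p'<r₀ , inj₂ inX , r₀≤P | s₀ , q'<s₀ , inj₂ inX' , s₀≤1+q =
      c2 r₀ q' p' s₀ inX inX' p'<r₀ q'<s₀
        (InDiagram-downClosed partition cell (≤-trans (s≤s z≤n) p'<r₀) r₀≤P (≤-trans (s≤s z≤n) q'<s₀) s₀≤1+q)

    letter : ℕ
    letter = yLeft %ℕ N

    σ : ℤ → ℤ
    σ = gen k letter

    private
      letter%N : letter % N ≡ letter
      letter%N = m<n⇒m%n≡m (%N<N yLeft)

      yTop%N : yTop %ℕ N ≡ suc (letter % N) % N
      yTop%N = trans ([x+1]%N≡[1+x%N]%N yLeft) (cong (λ t → suc t % N) (sym letter%N))

      yLeft≢yTop : yLeft ≢ yTop
      yLeft≢yTop e = ℤP.<-irrefl e yLeft<yTop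

    σ-yLeft : σ yLeft ≡ yTop
    σ-yLeft with genCase letter yLeft
    ... | raises _ e = e
    ... | lowers ¬raised _ _ = ⊥-elim (¬raised (sym letter%N))
    ... | fixes ¬raised _ _ = ⊥-elim (¬raised (sym letter%N))

    σ-yTop : σ yTop ≡ yLeft
    σ-yTop with genCase letter yTop
    ... | raises p _ = ⊥-elim (yLeft≢yTop (sym (%ℕ-injective-on-window inWindow-yTop inWindow-yLeft (trans p letter%N))))
    ... | lowers _ _ e = trans e (cancel yLeft)
      where cancel : ∀ x → (x ℤ.+ ℤ.1ℤ) ℤ.- ℤ.1ℤ ≡ x
            cancel = solve-∀
    ... | fixes _ ¬lowered _ = ⊥-elim (¬lowered yTop%N)

    σ-other : ∀ {x} → InWindow x → x ≢ yLeft → x ≢ yTop → σ x ≡ x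
    σ-other {x} wx x≢yLeft x≢yTop with genCase letter x
    ... | raises p _ = ⊥-elim (x≢yLeft (%ℕ-injective-on-window wx inWindow-yLeft (trans p letter%N)))
    ... | lowers _ p _ = ⊥-elim (x≢yTop (%ℕ-injective-on-window wx inWindow-yTop (trans p (sym yTop%N))))
    ... | fixes _ _ e = e

    σ-window : ∀ {x} → InWindow x → InWindow (σ x)
    σ-window {x} wx with x ℤ.≟ yLeft | x ℤ.≟ yTop
    ... | yes refl | _ = subst InWindow (sym σ-yLeft) inWindow-yTop
    ... | no _ | yes refl = subst InWindow (sym σ-yTop) inWindow-yLeft
    ... | no x≢yLeft | no x≢yTop = subst InWindow (sym (σ-other wx x≢yLeft x≢yTop)) wx

    module _ {p' q' : ℕ} where

      ExitsDown-cross : ∀ {z} → InWindow z → ExitsDown P q p' q' z → ExitsDown P (suc q) p' q' (σ z)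
      ExitsDown-cross {z} wz down with z ℤ.≟ yLeft | z ℤ.≟ yTop
      ... | yes refl | _ = subst (ExitsDown P (suc q) p' q') (sym σ-yLeft) (ExitsDown-cross-yLeft down)
      ... | no _ | yes refl = subst (ExitsDown P (suc q) p' q') (sym σ-yTop) (ExitsDown-cross-yTop down)
      ... | no z≢yLeft | no z≢yTop =
        subst (ExitsDown P (suc q) p' q') (sym (σ-other wz z≢yLeft z≢yTop)) (ExitsDown-other z≢yLeft z≢yTop down)

      ExitsRight-cross : ∀ {z} → InWindow z → ExitsRight P q p' q' z → ExitsRight P (suc q) p' q' (σ z)
      ExitsRight-cross {z} wz right with z ℤ.≟ yLeft | z ℤ.≟ yTop
      ... | yes refl | _ = subst (ExitsRight P (suc q) p' q') (sym σ-yLeft) (ExitsRight-cross-yLeft right)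
      ... | no _ | yes refl = subst (ExitsRight P (suc q) p' q') (sym σ-yTop) (ExitsRight-cross-yTop right)
      ... | no z≢yLeft | no z≢yTop =
        subst (ExitsRight P (suc q) p' q') (sym (σ-other wz z≢yLeft z≢yTop)) (ExitsRight-other z≢yLeft z≢yTop right)

      module _ (elbow : Elbow P (suc q)) where

        ExitsDown-elbow : ∀ {z} → ExitsDown P q p' q' z → ExitsDown P (suc q) p' q' z
        ExitsDown-elbow {z} down with z ℤ.≟ yLeft | z ℤ.≟ yTop
        ... | yes refl | _ = ExitsDown-elbow-yLeft elbow down
        ... | no _ | yes refl = ExitsDown-elbow-yTop elbow down
        ... | no z≢yLeft | no z≢yTop = ExitsDown-other z≢yLeft z≢yTop down

        ExitsRight-elbow : ∀ {z} → ExitsRight P q p' q' z → ExitsRight P (suc q) p' q' z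
        ExitsRight-elbow {z} right with z ℤ.≟ yLeft | z ℤ.≟ yTop
        ... | yes refl | _ = ExitsRight-elbow-yLeft elbow right
        ... | no _ | yes refl = ExitsRight-elbow-yTop elbow right
        ... | no z≢yLeft | no z≢yTop = ExitsRight-other z≢yLeft z≢yTop right

    PipeInvariant-elbow : Elbow P (suc q) → ∀ {f} → PipeInvariant P q f → PipeInvariant P (suc q) f
    PipeInvariant-elbow elbow inv = record
      { maps-window = maps-window
      ; onto-window = onto-window
      ; inversion-crossed = λ wi wj i<j fj<fi → crossed (inversion-crossed wi wj i<j fj<fi)
      }
      where
        open PipeInvariant inv
        crossed : ∀ {u v} → Crossed P q u v → Crossed P (suc q) u v
        crossed (p' , q' , 1≤p' , 1≤q' , down , right) =
          p' , q' , 1≤p' , 1≤q' , ExitsDown-elbow elbow down , ExitsRight-elbow elbow right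

    module _ {f : ℤ → ℤ} (inv : PipeInvariant P q f) where

      open PipeInvariant inv

      private
        new-pair : ∀ {i j} → InWindow i → f i ℤ.≤ f j → σ (f j) ℤ.< σ (f i) → f i ≡ yLeft × f j ≡ yTop
        new-pair {i} {j} wi fi≤fj lt with gen-inversion letter (f i) (f j) fi≤fj lt
        ... | fj≡ , fi%N = fi≡yLeft , trans fj≡ (cong (ℤ._+ ℤ.1ℤ) fi≡yLeft)
          where fi≡yLeft = %ℕ-injective-on-window (maps-window wi) inWindow-yLeft (trans fi%N letter%N)

      PipeInvariant-cross : PipeInvariant P (suc q) (σ ∘ f)
      PipeInvariant-cross = record
        { maps-window = σ-window ∘ maps-window
        ; onto-window = onto
        ; inversion-crossed = crossed
        }
        where
          onto : ∀ {y} → InWindow y → Σ ℤ λ i → InWindow i × σ (f i) ≡ y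
          onto {y} wy with onto-window (σ-window wy)
          ... | i , wi , fi≡σy = i , wi , trans (cong σ fi≡σy) (gen-involutive 1≤k letter y)

          crossed : ∀ {i j} → InWindow i → InWindow j → i ℤ.< j → σ (f j) ℤ.< σ (f i) → Crossed P (suc q) (σ (f j)) (σ (f i))
          crossed {i} {j} wi wj i<j lt with f j ℤ.<? f i
          ... | yes old with inversion-crossed wi wj i<j old
          ...   | p' , q' , 1≤p' , 1≤q' , down , right =
                  p' , q' , 1≤p' , 1≤q' , ExitsDown-cross (maps-window wj) down , ExitsRight-cross (maps-window wi) right
          crossed {i} {j} wi wj i<j lt | no ¬old with new-pair wi (ℤP.≮⇒≥ ¬old) lt
          ... | fi≡yLeft , fj≡yTop =
                subst₂ (Crossed P (suc q)) (sym (trans (cong σ fj≡yTop) σ-yTop)) (sym (trans (cong σ fi≡yLeft) σ-yLeft))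
                  (P , suc q , 1≤P , s≤s z≤n ,
                   inj₁ (P , suc q , HEdge-yLeft-new , refl , ≤-refl) , inj₁ (P , suc q , VEdge-yTop-new , refl , ≤-refl))

      -- Old inversions survive by ¬Crossed-yLeft-yTop; the new one is the pair
      -- of preimages of yLeft and yTop.
      inversions-cross : InDiagram lam (P , suc q) → inversions f + 1 ≤ inversions (σ ∘ f)
      inversions-cross cell with onto-window inWindow-yLeft | onto-window inWindow-yTop
      ... | i₀ , wi₀ , fi₀≡yLeft | j₀ , wj₀ , fj₀≡yTop =
        ≤-trans (+-monoʳ-≤ (inversions f) (filter-some (inverted? (σ ∘ f) ∩? ∁? (inverted? f)) new))
                (count-+-new-≤ (inverted? f) (inverted? (σ ∘ f)) pairs survives)
        where
          σσ : ∀ x → σ (σ x) ≡ x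
          σσ = gen-involutive 1≤k letter

          survives : ∀ {e} → e ∈ pairs → Inverted f e → Inverted (σ ∘ f) e
          survives {i , j} e∈ (i<j , fj<fi) with σ (f j) ℤ.<? σ (f i)
          ... | yes lt = i<j , lt
          ... | no ¬lt with ∈-pairs⁻ e∈
          ...   | wi , wj with gen-inversion letter (σ (f i)) (σ (f j)) (ℤP.≮⇒≥ ¬lt)
                             (subst₂ ℤ._<_ (sym (σσ (f j))) (sym (σσ (f i))) fj<fi)
          ...     | σfj≡σfi+1 , σfi%N = ⊥-elim (¬Crossed-yLeft-yTop cell
                      (subst₂ (Crossed P q) fj≡yLeft fi≡yTop (inversion-crossed wi wj i<j fj<fi)))
            where
              σfi≡yLeft : σ (f i) ≡ yLeft
              σfi≡yLeft = %ℕ-injective-on-window (σ-window (maps-window wi)) inWindow-yLeft (trans σfi%N letter%N)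
              fi≡yTop : f i ≡ yTop
              fi≡yTop = trans (sym (σσ (f i))) (trans (cong σ σfi≡yLeft) σ-yLeft)
              fj≡yLeft : f j ≡ yLeft
              fj≡yLeft = trans (sym (σσ (f j))) (trans (cong σ (trans σfj≡σfi+1 (cong (ℤ._+ ℤ.1ℤ) σfi≡yLeft))) σ-yTop)

          fi₀<fj₀ : f i₀ ℤ.< f j₀
          fi₀<fj₀ = subst₂ ℤ._<_ (sym fi₀≡yLeft) (sym fj₀≡yTop) yLeft<yTop

          i₀<j₀ : i₀ ℤ.< j₀
          i₀<j₀ with ℤP.<-cmp i₀ j₀
          ... | tri< lt _ _ = lt
          ... | tri≈ _ refl _ = ⊥-elim (yLeft≢yTop (trans (sym fi₀≡yLeft) fj₀≡yTop))
          ... | tri> _ _ gt = ⊥-elim (¬Crossed-yLeft-yTop cell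
                                (subst₂ (Crossed P q) fi₀≡yLeft fj₀≡yTop (inversion-crossed wj₀ wi₀ gt fi₀<fj₀)))

          σfj₀<σfi₀ : σ (f j₀) ℤ.< σ (f i₀)
          σfj₀<σfi₀ = subst₂ ℤ._<_ (sym (trans (cong σ fj₀≡yTop) σ-yTop)) (sym (trans (cong σ fi₀≡yLeft) σ-yLeft)) yLeft<yTop

          new : Any (Inverted (σ ∘ f) ∩ ∁ (Inverted f)) pairs
          new = Any.map (λ { refl → (i₀<j₀ , σfj₀<σfi₀) , λ (_ , fj₀<fi₀) → ℤP.<-asym fj₀<fi₀ fi₀<fj₀ }) (∈-pairs⁺ wi₀ wj₀)

  crosses : ℕ → ℕ → Bool
  crosses p q = inDiagramᵇ lam p q ∧ not (memberᵇ X p q)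

  crosses⇒InDiagram : ∀ {p q} → crosses p q ≡ true → InDiagram lam (p , q)
  crosses⇒InDiagram {p} {q} e with inDiagramᵇ lam p q in e₁
  ... | true = inDiagramᵇ⇒InDiagram lam e₁

  ¬crosses⇒Elbow : ∀ {p q} → crosses p q ≡ false → Elbow p q
  ¬crosses⇒Elbow {p} {q} e with memberᵇ X p q in e₁
  ... | true = inj₂ (memberᵇ⇒∈ X e₁)
  ... | false = inj₁ λ cell → true≢false (trans (sym (cong (_∧ true) (InDiagram⇒inDiagramᵇ lam cell))) e)
    where true≢false : true ≢ false
          true≢false ()

  Tracks : ℕ → ℕ → Word → Set
  Tracks P q w = PipeInvariant P q (act k w) × length w ≤ inversions (act k w)

  partialWord : ℕ → ℕ → Word
  partialWord p₀ q = readRow k crosses (suc p₀) q ++ readRows k crosses p₀ c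

  Tracks-nextCell : ∀ {p₀ q} → suc q ≤ c → suc p₀ ≤ R →
                    Tracks (suc p₀) q (partialWord p₀ q) → Tracks (suc p₀) (suc q) (partialWord p₀ (suc q))
  Tracks-nextCell {p₀} {q} 1+q≤c 1+p₀≤R tracks =
    subst (Tracks (suc p₀) (suc q)) (sym (++-assoc (letterIf (crosses (suc p₀) (suc q))) (readRow k crosses (suc p₀) q) (readRows k crosses p₀ c)))
      (step (crosses (suc p₀) (suc q)) refl tracks)
    where
      open AtCell (suc p₀) q 1+q≤c (s≤s z≤n) 1+p₀≤R
      letterIf : Bool → Word
      letterIf b = if b then residue k (suc p₀) (suc q) ∷ [] else []
      step : ∀ b → crosses (suc p₀) (suc q) ≡ b → Tracks (suc p₀) q (partialWord p₀ q) →
             Tracks (suc p₀) (suc q) (letterIf b ++ partialWord p₀ q)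
      step true e (inv , length≤) =
        PipeInvariant-cross inv , ≤-trans (≤-reflexive (+-comm 1 _)) (≤-trans (+-monoˡ-≤ 1 length≤) (inversions-cross inv (crosses⇒InDiagram e)))
      step false e (inv , length≤) = PipeInvariant-elbow (¬crosses⇒Elbow e) inv , length≤

  Tracks-row : ∀ p₀ {q} → q ≤ c → suc p₀ ≤ R → Tracks (suc p₀) 0 (partialWord p₀ 0) → Tracks (suc p₀) q (partialWord p₀ q)
  Tracks-row p₀ {zero} _ _ tracks = tracks
  Tracks-row p₀ {suc q} 1+q≤c 1+p₀≤R tracks = Tracks-nextCell 1+q≤c 1+p₀≤R (Tracks-row p₀ (<⇒≤ 1+q≤c) 1+p₀≤R tracks)

  Tracks-rows : ∀ p₀ → suc p₀ ≤ R → Tracks (suc p₀) c (partialWord p₀ c)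
  Tracks-rows zero 1≤R = Tracks-row 0 ≤-refl 1≤R (identity , z≤n)
    where
      identity : PipeInvariant 1 0 (act k [])
      identity = record
        { maps-window = λ wi → wi
        ; onto-window = λ {y} wy → y , wy , refl
        ; inversion-crossed = λ _ _ i<j j<i → ⊥-elim (ℤP.<-asym i<j j<i)
        }
  Tracks-rows (suc p₀) 2+p₀≤R =
    Tracks-row (suc p₀) ≤-refl 2+p₀≤R (map₁ PipeInvariant-nextRow (Tracks-rows p₀ (<⇒≤ 2+p₀≤R)))

  readingWord-reduced : Reduced k (readingWordMinus k lam X R c)
  readingWord-reduced v v≈w = begin
    length w                   ≤⟨ length≤ ⟩
    inversions (act k w)       ≡⟨ cong length (filter-≐ (inverted? (act k w)) (inverted? (act k v)) same-inversions pairs) ⟩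
    inversions (act k v)       ≤⟨ inversions≤length v ⟩
    length v                   ∎
    where
      open ≤-Reasoning
      w : Word
      w = readingWordMinus k lam X R c
      R≡1+[k∸c] : R ≡ suc (k ∸ c)
      R≡1+[k∸c] = +-∸-assoc 1 c≤k
      length≤ : length w ≤ inversions (act k w)
      length≤ = subst (λ n → length (readRows k crosses n c) ≤ inversions (act k (readRows k crosses n c))) (sym R≡1+[k∸c])
                  (proj₂ (Tracks-rows (k ∸ c) (≤-reflexive (sym R≡1+[k∸c]))))
      same-inversions : Inverted (act k w) ≐ Inverted (act k v)
      same-inversions = (λ {(i , j)} (i<j , lt) → i<j , subst₂ ℤ._<_ (sym (v≈w j)) (sym (v≈w i)) lt)
                      , (λ {(i , j)} (i<j , lt) → i<j , subst₂ ℤ._<_ (v≈w j) (v≈w i) lt)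

module ReadingWordLength (k : ℕ) where

  indicator : Bool → ℕ
  indicator b = if b then 1 else 0

  length-readRow-suc : ∀ D p q → length (readRow k D p (suc q)) ≡ indicator (D p (suc q)) + length (readRow k D p q)
  length-readRow-suc D p q with D p (suc q)
  ... | true = refl
  ... | false = refl

  module _ (D D₁ D₂ : ℕ → ℕ → Bool) (split : ∀ p q → indicator (D p q) ≡ indicator (D₁ p q) + indicator (D₂ p q)) where

    length-readRow-split : ∀ p q → length (readRow k D p q) ≡ length (readRow k D₁ p q) + length (readRow k D₂ p q)
    length-readRow-split p zero = refl
    length-readRow-split p (suc q) = begin
      length (readRow k D p (suc q))                                 ≡⟨ length-readRow-suc D p q ⟩
      indicator (D p (suc q)) + length (readRow k D p q)            ≡⟨ cong₂ _+_ (split p (suc q)) (length-readRow-split p q) ⟩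
      (indicator (D₁ p (suc q)) + indicator (D₂ p (suc q))) + (length (readRow k D₁ p q) + length (readRow k D₂ p q))
                                                                     ≡⟨ interchange (indicator (D₁ p (suc q))) (indicator (D₂ p (suc q))) (length (readRow k D₁ p q)) (length (readRow k D₂ p q)) ⟩
      (indicator (D₁ p (suc q)) + length (readRow k D₁ p q)) + (indicator (D₂ p (suc q)) + length (readRow k D₂ p q))
                                                                     ≡⟨ cong₂ _+_ (length-readRow-suc D₁ p q) (length-readRow-suc D₂ p q) ⟨
      length (readRow k D₁ p (suc q)) + length (readRow k D₂ p (suc q)) ∎
      where open ≡-Reasoning

    length-readRows-split : ∀ nr nc → length (readRows k D nr nc) ≡ length (readRows k D₁ nr nc) + length (readRows k D₂ nr nc)
    length-readRows-split zero nc = refl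
    length-readRows-split (suc p) nc = begin
      length (readRows k D (suc p) nc)                                 ≡⟨ length-++ (readRow k D (suc p) nc) ⟩
      length (readRow k D (suc p) nc) + length (readRows k D p nc)     ≡⟨ cong₂ _+_ (length-readRow-split (suc p) nc) (length-readRows-split p nc) ⟩
      (length (readRow k D₁ (suc p) nc) + length (readRow k D₂ (suc p) nc)) + (length (readRows k D₁ p nc) + length (readRows k D₂ p nc))
                                                                       ≡⟨ interchange (length (readRow k D₁ (suc p) nc)) (length (readRow k D₂ (suc p) nc)) (length (readRows k D₁ p nc)) (length (readRows k D₂ p nc)) ⟩
      (length (readRow k D₁ (suc p) nc) + length (readRows k D₁ p nc)) + (length (readRow k D₂ (suc p) nc) + length (readRows k D₂ p nc))
                                                                       ≡⟨ cong₂ _+_ (length-++ (readRow k D₁ (suc p) nc)) (length-++ (readRow k D₂ (suc p) nc)) ⟨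
      length (readRows k D₁ (suc p) nc) + length (readRows k D₂ (suc p) nc) ∎
      where open ≡-Reasoning

  length-readRow-none : ∀ D p q → (∀ {q'} → q' ≤ q → D p q' ≡ false) → length (readRow k D p q) ≡ 0
  length-readRow-none D p zero _ = refl
  length-readRow-none D p (suc q) none =
    trans (length-readRow-suc D p q)
          (cong₂ _+_ (cong indicator (none ≤-refl)) (length-readRow-none D p q (none ∘ m≤n⇒m≤1+n)))

  length-readRows-none : ∀ D nr nc → (∀ {p q} → p ≤ nr → D p q ≡ false) → length (readRows k D nr nc) ≡ 0
  length-readRows-none D zero nc _ = refl
  length-readRows-none D (suc p) nc none =
    trans (length-++ (readRow k D (suc p) nc))
          (cong₂ _+_ (length-readRow-none D (suc p) nc (λ _ → none ≤-refl)) (length-readRows-none D p nc (none ∘ m≤n⇒m≤1+n)))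

  isCell : ℕ → ℕ → ℕ → ℕ → Bool
  isCell i j p q = (i ≡ᵇ p) ∧ (j ≡ᵇ q)

  private
    ≡ᵇ-refl : ∀ n → (n ≡ᵇ n) ≡ true
    ≡ᵇ-refl zero = refl
    ≡ᵇ-refl (suc n) = ≡ᵇ-refl n

    ≢⇒≡ᵇ-false : ∀ {m n} → m ≢ n → (m ≡ᵇ n) ≡ false
    ≢⇒≡ᵇ-false {m} {n} m≢n with m ≡ᵇ n in e
    ... | true = ⊥-elim (m≢n (≡ᵇ-true⇒≡ e))
    ... | false = refl

    isCell-otherColumn : ∀ i j q → j ≢ q → isCell i j i q ≡ false
    isCell-otherColumn i j q j≢q = trans (cong (_∧ (j ≡ᵇ q)) (≡ᵇ-refl i)) (≢⇒≡ᵇ-false j≢q)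

    isCell-otherRow : ∀ i j p q → i ≢ p → isCell i j p q ≡ false
    isCell-otherRow i j p q i≢p = cong (_∧ (j ≡ᵇ q)) (≢⇒≡ᵇ-false i≢p)

  length-readRow-isCell : ∀ i j q → 1 ≤ j → j ≤ q → length (readRow k (isCell i j) i q) ≡ 1
  length-readRow-isCell i j zero 1≤j j≤0 with () ← ≤-trans 1≤j j≤0
  length-readRow-isCell i j (suc q) 1≤j j≤1+q with j ≟ suc q
  ... | yes refl = trans (length-readRow-suc (isCell i j) i q)
                     (cong₂ _+_ (cong indicator (cong₂ _∧_ (≡ᵇ-refl i) (≡ᵇ-refl j)))
                                (length-readRow-none (isCell i j) i q (λ {q'} q'≤q → isCell-otherColumn i j q' (<⇒≢ (s≤s q'≤q) ∘ sym))))
  ... | no j≢1+q = trans (length-readRow-suc (isCell i j) i q)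
                     (cong₂ _+_ (cong indicator (isCell-otherColumn i j (suc q) j≢1+q)) (length-readRow-isCell i j q 1≤j (≤-pred (≤∧≢⇒< j≤1+q j≢1+q))))

  length-readRows-isCell : ∀ i j nr nc → 1 ≤ i → i ≤ nr → 1 ≤ j → j ≤ nc → length (readRows k (isCell i j) nr nc) ≡ 1
  length-readRows-isCell i j zero nc 1≤i i≤0 _ _ with () ← ≤-trans 1≤i i≤0
  length-readRows-isCell i j (suc p) nc 1≤i i≤1+p 1≤j j≤nc with i ≟ suc p
  ... | yes refl = trans (length-++ (readRow k (isCell i j) i nc))
                     (cong₂ _+_ (length-readRow-isCell i j nc 1≤j j≤nc)
                                (length-readRows-none (isCell i j) p nc (λ {p'} {q'} p'≤p → isCell-otherRow i j p' q' (<⇒≢ (s≤s p'≤p) ∘ sym))))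
  ... | no i≢1+p = trans (length-++ (readRow k (isCell i j) (suc p) nc))
                     (cong₂ _+_ (length-readRow-none (isCell i j) (suc p) nc (λ {q'} _ → isCell-otherRow i j (suc p) q' i≢1+p))
                                (length-readRows-isCell i j p nc 1≤i (≤-pred (≤∧≢⇒< i≤1+p i≢1+p)) 1≤j j≤nc))

  private
    indicator-∧-∨ : ∀ a e m → (e ≡ true → a ≡ true × m ≡ false) → indicator (a ∧ (e ∨ m)) ≡ indicator e + indicator (a ∧ m)
    indicator-∧-∨ true true m h rewrite proj₂ (h refl) = refl
    indicator-∧-∨ false true m h with () ← proj₁ (h refl)
    indicator-∧-∨ true false m _ = refl
    indicator-∧-∨ false false m _ = refl

  module _ {lam : List ℕ} {c nr : ℕ} (rect : InRect lam c nr) where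

    private
      removed : List Cell → ℕ → ℕ → Bool
      removed X p q = inDiagramᵇ lam p q ∧ memberᵇ X p q

    length-readRows-removed : ∀ X → Unique X → All (InDiagram lam) X → length (readRows k (removed X) nr c) ≡ length X
    length-readRows-removed [] _ _ = length-readRows-none (removed []) nr c (λ {p} {q} _ → ∧-zeroʳ (inDiagramᵇ lam p q))
    length-readRows-removed ((i , j) ∷ X) (i,j∉X ∷ unique) (cell@(1≤j , j≤row) ∷ cells) =
      trans (length-readRows-split (removed ((i , j) ∷ X)) (isCell i j) (removed X) split nr c)
            (cong₂ _+_ (length-readRows-isCell i j nr c 1≤i (≤-trans i≤length (proj₁ rect)) 1≤j (≤-trans j≤row (rowLen≤ (proj₂ rect) i)))
                       (length-readRows-removed X unique cells))
      where
        open Diagrams using (rowLen≤; nonempty-row≤length)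
        1≤i : 1 ≤ i
        1≤i = proj₁ (nonempty-row≤length lam i (≤-trans 1≤j j≤row))
        i≤length : i ≤ length lam
        i≤length = proj₂ (nonempty-row≤length lam i (≤-trans 1≤j j≤row))
        i,j∉ᵇX : memberᵇ X i j ≡ false
        i,j∉ᵇX with memberᵇ X i j in e
        ... | true = ⊥-elim (All.lookup i,j∉X (memberᵇ⇒∈ X e) refl)
        ... | false = refl
        split : ∀ p q → indicator (removed ((i , j) ∷ X) p q) ≡ indicator (isCell i j p q) + indicator (removed X p q)
        split p q = indicator-∧-∨ (inDiagramᵇ lam p q) (isCell i j p q) (memberᵇ X p q) λ e →
          subst₂ (λ p q → inDiagramᵇ lam p q ≡ true × memberᵇ X p q ≡ false)
                 (≡ᵇ-true⇒≡ (∧-conicalˡ (i ≡ᵇ p) (j ≡ᵇ q) e)) (≡ᵇ-true⇒≡ (∧-conicalʳ (i ≡ᵇ p) (j ≡ᵇ q) e))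
                 (InDiagram⇒inDiagramᵇ lam cell , i,j∉ᵇX)

    length-readingWordMinus : ∀ X → Unique X → All (InDiagram lam) X →
                              length (readingWordMinus k lam [] nr c) ≡ length (readingWordMinus k lam X nr c) + length X
    length-readingWordMinus X unique cells =
      trans (length-readRows-split (λ p q → inDiagramᵇ lam p q ∧ not false) (λ p q → inDiagramᵇ lam p q ∧ not (memberᵇ X p q))
                                   (removed X) split nr c)
            (cong (_+_ (length (readingWordMinus k lam X nr c))) (length-readRows-removed X unique cells))
      where
        split : ∀ p q → indicator (inDiagramᵇ lam p q ∧ not false) ≡ indicator (inDiagramᵇ lam p q ∧ not (memberᵇ X p q)) + indicator (removed X p q)
        split p q with inDiagramᵇ lam p q | memberᵇ X p q
        ... | true | true = refl
        ... | true | false = refl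
        ... | false | _ = refl

IsLength-of-reduced : ∀ {k} u {n} → Reduced k u → IsLength k u n → n ≡ length u
IsLength-of-reduced u reduced ((v , length-v , v≈u) , minimal) =
  ≤-antisym (minimal u (λ _ → refl)) (≤-trans (reduced v v≈u) (≤-reflexive length-v))

lemma4p11 : (k c : ℕ) (lam : List ℕ) (X : List Cell) →
    1 ≤ k → c ≤ k →
    IsPartition lam → InRect lam c (suc k ∸ c) →
    Unique X → All (InDiagram lam) X → C2 lam X →
    Reduced k (readingWordMinus k lam X (suc k ∸ c) c) ×
    (∀ n m → IsLength k (readingWordMinus k lam [] (suc k ∸ c) c) n →
    IsLength k (readingWordMinus k lam X (suc k ∸ c) c) m →
    m + length X ≡ n)
lemma4p11 k c lam X 1≤k c≤k partition rect unique cells c2 = reduced , lengths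
  where
    w w₀ : Word
    w = readingWordMinus k lam X (suc k ∸ c) c
    w₀ = readingWordMinus k lam [] (suc k ∸ c) c
    reduced : Reduced k w
    reduced = Pipes.readingWord-reduced k 1≤k c c≤k lam X partition c2
    reduced₀ : Reduced k w₀
    reduced₀ = Pipes.readingWord-reduced k 1≤k c c≤k lam [] partition (λ _ _ _ _ ())
    lengths : ∀ n m → IsLength k w₀ n → IsLength k w m → m + length X ≡ n
    lengths n m ℓ₀ ℓ = begin
      m + length X          ≡⟨ cong (_+ length X) (IsLength-of-reduced w reduced ℓ) ⟩
      length w + length X   ≡⟨ ReadingWordLength.length-readingWordMinus k rect X unique cells ⟨
      length w₀             ≡⟨ IsLength-of-reduced w₀ reduced₀ ℓ₀ ⟨
      n                     ∎
      where open ≡-Reasoning
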